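{- Let $\delta$ be a Displacement calculus natural deduction proof of $\alpha_1:A_1,\ldots,\alpha_n:A_n \vdash \gamma:C$. Then there is a proof net with the same hypotheses $A_1,\dots,A_n$ (and conclusion $C$) whose abstract proof structure contracts, by a finite sequence of contractions, to a comb with conclusion $C$ whose sequence of premisses is the string $\gamma$.
   Context: Displacement calculus. String terms are finite sequences (associative concatenation $+$) over variables (sort 0) and a separator constant $\mathbf{1}$; sort = number of occurrences of $\mathbf{1}$. Wrap: $(a+\mathbf{1}+\alpha)\times_{>}\beta=a+\beta+\alpha$, $(\alpha+\mathbf{1}+a)\times_{<}\beta=\alpha+\beta+a$ ($a$ separator-free), and for positive integer $n$, $\times_n$ replaces the $n$-th separator by $\beta$. Formulas: atoms with given sorts, and $A\bullet B$, $A\backslash C$, $C/B$, $A\odot_k B$, $A\downarrow_k C$, $C\uparrow_k B$ ($k\in\{>,<\}$ or positive integer), with sorts $s(A\bullet B)=s(A)+s(B)$, $s(A\backslash C)=s(C)-s(A)$, $s(C/B)=s(C)-s(B)$, $s(A\odot_kB)=s(A)+s(B)-1$, $s(A\downarrow_kC)=s(C)+1-s(A)$, $s(C\uparrow_kB)=s(C)+1-s(B)$ (all required nonnegative, arguments of wrap sort $\ge1$). Natural deduction on labelled formulas $\alpha:A$: $\backslash E$ ($\alpha:A$, $\gamma:A\backslash C\Rightarrow \alpha+\gamma:C$), $\backslash I$ (derive $\alpha+\gamma:C$ from $[\alpha:A]$, conclude $\gamma:A\backslash C$), $/E,/I$ symmetric, $\bullet I$ ($\alpha:A,\beta:B\Rightarrow\alpha+\beta:A\bullet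 B$), $\bullet E$ (from $\delta:A\bullet B$ and a derivation of $\gamma[\alpha+\beta]:C$ from $[\alpha:A],[\beta:B]$ conclude $\gamma[\delta]:C$); $\downarrow_>E$ ($a+\mathbf{1}+\alpha:A$, $\gamma:A\downarrow_>C\Rightarrow a+\gamma+\alpha:C$), $\downarrow_>I$ (derive $a+\gamma+\alpha:C$ from $[a+\mathbf{1}+\alpha:A]$, conclude $\gamma:A\downarrow_>C$), $\uparrow_>E$ ($c+\mathbf{1}+\gamma:C\uparrow_>B$, $\beta:B\Rightarrow c+\beta+\gamma:C$), $\uparrow_>I$ (derive $c+\beta+\gamma:C$ from $[\beta:B]$, conclude $c+\mathbf{1}+\gamma:C\uparrow_>B$), $\odot_>I$ ($a+\mathbf{1}+\alpha:A$, $\beta:B\Rightarrow a+\beta+\alpha:A\odot_>B$), $\odot_>E$ (from $\delta:A\odot_>B$ and a derivation of $\gamma[a+\beta+\alpha]:C$ from $[a+\mathbf{1}+\alpha:A],[\beta:B]$ conclude $\gamma[\delta]:C$); for $k=<$ or integer $k$ the same with the last, resp. $k$-th, separator. Hypotheses of sort $n$ carry strings $p_0+\mathbf{1}+\dots+\mathbf{1}+p_n$ with fresh variables. Proof structures: sets of formula occurrences and links (central node, ordered premisses, ordered conclusions), each formula premiss of at most one link and conclusion of at most one link. Tensor links: $[L/]$ ($+$; $C/B,B\to C$), $[L\backslash]$ ($+$; $A,A\backslash C\to C$), $[R\bullet]$ ($+$; $A,B\to A\bullet B$), $[L\uparrow_k]$ ($\times_k$; $C\uparrow_kB,B\to C$),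 $[L\downarrow_k]$ ($\times_k$; $A,A\downarrow_kC\to C$), $[R\odot_k]$ ($\times_k$; $A,B\to A\odot_kB$). Par links with a main formula: $[L\bullet]$ ($A\bullet B$ main $\to A,B$), $[L\odot_k]$ ($A\odot_kB$ main $\to A,B$), $[R/]$ ($C\to C/B$ main, $B$), $[R\backslash]$ ($C\to A$, $A\backslash C$ main), $[R\uparrow_k]$ ($C\to C\uparrow_kB$ main, $B$), $[R\downarrow_k]$ ($C\to A$, $A\downarrow_kC$ main). Hypotheses: formulas that are conclusion of no link; conclusions: formulas premiss of no link; auxiliary inputs: non-main conclusions of par links. A proof net is a proof structure corresponding to a natural deduction proof (tensor links to $/E,\backslash E,\bullet I,\uparrow_kE,\downarrow_kE,\odot_kI$, par links to $/I,\backslash I,\bullet E,\uparrow_kI,\downarrow_kI,\odot_kE$). Abstract proof structure: a comb is a link with an ordered list of premisses (vertices or $\mathbf{1}$) and one conclusion; its sort is the sum of premiss sorts ($\mathbf{1}$ sort 1). Replace each $+$ link $v_1,v_2\to v_3$ by a comb $v_1,v_2\to v_3$; replace each hypothesis $A$ of sort $n$ with string $p_0+\mathbf{1}+\dots+\mathbf{1}+p_n$ by an unlabelled vertex that is conclusion of a comb with premisses $p_0,\mathbf{1},\dots,\mathbf{1},p_n$; replace each auxiliary input of sort $n$ by an unlabelled vertex that is conclusion of a comb with premisses $w_0,\mathbf{1},\dots,\mathbf{1},w_n$ (new vertices), the par link now connected to $w_0,\dots,w_n$; the conclusion keeps its formula, other vertices become unlabelled. Contractions: [$+$] a comb $\alpha_1,u,\alpha_2\to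 v$ with $u$ conclusion of a comb $\beta\to u$ becomes $\alpha_1,\beta,\alpha_2\to v$. [$\times_k$] a $\times_k$ link whose first premiss is conclusion of a comb $\alpha_1,\mathbf{1},\alpha_2$ and second of a comb $\beta$, conclusion $v$, with the displayed separator the first ($>$), last ($<$) or $k$-th one, becomes $\alpha_1,\beta,\alpha_2\to v$. For a par link with main vertex $v$ and auxiliary input split into $w_0..w_n$, $W=w_0,\mathbf{1},\dots,\mathbf{1},w_n$: [$\backslash$] premiss of $[R\backslash]$ conclusion of comb $W,\beta$ gives $\beta\to v$; [$/$] with $\beta,W$; [$\uparrow_k$] comb $\alpha_1,W,\alpha_2$ (sort condition on $\alpha_1$/$\alpha_2$ per $k$ as for $\times_k$) gives $\alpha_1,\mathbf{1},\alpha_2\to v$; [$\downarrow_k$] comb $w_0,\mathbf{1},\dots,w_j,\beta,w_{j+1},\dots,\mathbf{1},w_n$ with $\beta$ inserted at the separator determined by $k$ gives $\beta\to v$; [$\bullet$] for $[L\bullet]$ with main premiss $v_1$ and split inputs $W_A,W_B$, a comb $\gamma_1,W_A,W_B,\gamma_2\to v_2$ becomes $\gamma_1,v_1,\gamma_2\to v_2$; [$\odot_k$] likewise with comb $\gamma_1,\alpha_1,W_B,\alpha_2,\gamma_2$ where $W_A=\alpha_1,\mathbf{1},\alpha_2$ with the separator chosen per $k$. In each logical contraction the par link is removed. -}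

module Defs where

open import Data.Nat using (ℕ; zero; suc; _+_; _∸_; _≤_)
open import Data.List using (List; []; _∷_; _++_; [_]; map; concatMap; sum; upTo; zip)
open import Data.List.Relation.Unary.All using (All; []; _∷_)
open import Data.List.Relation.Unary.All.Properties using (++⁺)
open import Data.List.Relation.Unary.Any using (Any)
open import Data.List.Relation.Unary.Unique.Propositional using (Unique)
open import Data.List.Membership.Propositional using (_∈_)
open import Data.List.Relation.Binary.Permutation.Propositional using (_↭_)
open import Data.List.Relation.Binary.Permutation.Propositional.Properties using (All-resp-↭)
open import Data.Maybe using (Maybe; just; nothing; maybe)
open import Data.Product using (Σ; _×_; _,_; proj₁; proj₂)
open import Data.Unit using (⊤)
open import Data.Bool using (Bool; true; false)
open import Relation.Binary.PropositionalEquality using (_≡_)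
open import Relation.Nullary using (¬_)
import Data.Nat
import Relation.Nullary
open import Relation.Binary.Construct.Closure.ReflexiveTransitive using (Star)

-- Modes of the discontinuous connectives:  >  (first separator),
-- <  (last separator),  nth n  (the n-th separator, n ≥ 1).

data Mode : Set where
  first : Mode
  last  : Mode
  nth   : ℕ → Mode

infixr 30 _•_
infixr 25 _⧹_
infixl 25 _⧸_

data Formula : Set where
  at      : (name : ℕ) (sortOf : ℕ) → Formula
  _•_     : Formula → Formula → Formula
  _⧹_     : Formula → Formula → Formula
  _⧸_     : Formula → Formula → Formula
  _⊙[_]_  : Formula → Mode → Formula → Formula
  _↓[_]_  : Formula → Mode → Formula → Formula
  _↑[_]_  : Formula → Mode → Formula → Formula

sort : Formula → ℕ
sort (at _ s)     = s
sort (A • B)      = sort A + sort B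
sort (A ⧹ C)      = sort C ∸ sort A
sort (C ⧸ B)      = sort C ∸ sort B
sort (A ⊙[ k ] B) = (sort A + sort B) ∸ 1
sort (A ↓[ k ] C) = suc (sort C) ∸ sort A
sort (C ↑[ k ] B) = suc (sort C) ∸ sort B

ModeOK : Mode → ℕ → Set
ModeOK first   m = 1 ≤ m
ModeOK last    m = 1 ≤ m
ModeOK (nth n) m = 1 ≤ n × n ≤ m

-- well-sortedness: all sorts nonnegative (the ∸ above is exact),
-- arguments of wrap of sort ≥ 1
WF : Formula → Set
WF (at _ _)     = ⊤
WF (A • B)      = WF A × WF B
WF (A ⧹ C)      = WF A × WF C × sort A ≤ sort C
WF (C ⧸ B)      = WF C × WF B × sort B ≤ sort C
WF (A ⊙[ k ] B) = WF A × WF B × ModeOK k (sort A)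
WF (A ↓[ k ] C) = WF A × WF C × sort A ≤ suc (sort C) × ModeOK k (sort A)
WF (C ↑[ k ] B) = WF C × WF B × sort B ≤ suc (sort C) × ModeOK k (suc (sort C) ∸ sort B)

data Sym : Set where
  var : ℕ → Sym
  𝟏   : Sym

Str : Set
Str = List Sym

seps : Str → ℕ
seps []            = 0
seps (var _ ∷ s)   = seps s
seps (𝟏 ∷ s)       = suc (seps s)

vars : Str → List ℕ
vars []          = []
vars (var x ∷ s) = x ∷ vars s
vars (𝟏 ∷ s)     = vars s

-- For a decomposition  a + 𝟏 + b, the displayed separator is the one
-- selected by the mode: first (a separator-free), last (b separator-free),
-- or the n-th one.
SepPos : Mode → Str → Str → Set
SepPos first   a b = seps a ≡ 0
SepPos last    a b = seps b ≡ 0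
SepPos (nth n) a b = suc (seps a) ≡ n

data HypLabel : Str → ℕ → Set where
  base : ∀ x → HypLabel (var x ∷ []) 0
  step : ∀ {α n} x → HypLabel α n → HypLabel (var x ∷ 𝟏 ∷ α) (suc n)

-- Labelled natural deduction.  A context is the list of open labelled
-- hypotheses (used linearly; exchange by the rule perm).

Ctx : Set
Ctx = List (Str × Formula)

infix 4 _⊢_∶_

data _⊢_∶_ : Ctx → Str → Formula → Set where
  hyp  : ∀ {α A} → WF A → HypLabel α (sort A) → [ (α , A) ] ⊢ α ∶ A
  perm : ∀ {Γ Δ α A} → Γ ↭ Δ → Γ ⊢ α ∶ A → Δ ⊢ α ∶ A
  ⧹E   : ∀ {Γ Δ α γ A C} → Γ ⊢ α ∶ A → Δ ⊢ γ ∶ A ⧹ C → Γ ++ Δ ⊢ α ++ γ ∶ C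
  ⧹I   : ∀ {Γ α γ A C} → (α , A) ∷ Γ ⊢ α ++ γ ∶ C → Γ ⊢ γ ∶ A ⧹ C
  ⧸E   : ∀ {Γ Δ γ β B C} → Γ ⊢ γ ∶ C ⧸ B → Δ ⊢ β ∶ B → Γ ++ Δ ⊢ γ ++ β ∶ C
  ⧸I   : ∀ {Γ γ β B C} → (β , B) ∷ Γ ⊢ γ ++ β ∶ C → Γ ⊢ γ ∶ C ⧸ B
  •I   : ∀ {Γ Δ α β A B} → Γ ⊢ α ∶ A → Δ ⊢ β ∶ B → Γ ++ Δ ⊢ α ++ β ∶ A • B
  •E   : ∀ {Γ Δ δ α β γ₁ γ₂ A B C} → Γ ⊢ δ ∶ A • B →
         (α , A) ∷ (β , B) ∷ Δ ⊢ γ₁ ++ α ++ β ++ γ₂ ∶ C →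
         Γ ++ Δ ⊢ γ₁ ++ δ ++ γ₂ ∶ C
  ↓E   : ∀ {Γ Δ k a α γ A C} → SepPos k a α →
         Γ ⊢ a ++ 𝟏 ∷ α ∶ A → Δ ⊢ γ ∶ A ↓[ k ] C → Γ ++ Δ ⊢ a ++ γ ++ α ∶ C
  ↓I   : ∀ {Γ k a α γ A C} → SepPos k a α →
         (a ++ 𝟏 ∷ α , A) ∷ Γ ⊢ a ++ γ ++ α ∶ C → Γ ⊢ γ ∶ A ↓[ k ] C
  ↑E   : ∀ {Γ Δ k c γ β B C} → SepPos k c γ →
         Γ ⊢ c ++ 𝟏 ∷ γ ∶ C ↑[ k ] B → Δ ⊢ β ∶ B → Γ ++ Δ ⊢ c ++ β ++ γ ∶ C
  ↑I   : ∀ {Γ k c γ β B C} → SepPos k c γ →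
         (β , B) ∷ Γ ⊢ c ++ β ++ γ ∶ C → Γ ⊢ c ++ 𝟏 ∷ γ ∶ C ↑[ k ] B
  ⊙I   : ∀ {Γ Δ k a α β A B} → SepPos k a α →
         Γ ⊢ a ++ 𝟏 ∷ α ∶ A → Δ ⊢ β ∶ B → Γ ++ Δ ⊢ a ++ β ++ α ∶ A ⊙[ k ] B
  ⊙E   : ∀ {Γ Δ k δ a α β γ₁ γ₂ A B C} → SepPos k a α →
         Γ ⊢ δ ∶ A ⊙[ k ] B →
         (a ++ 𝟏 ∷ α , A) ∷ (β , B) ∷ Δ ⊢ γ₁ ++ a ++ β ++ α ++ γ₂ ∶ C →
         Γ ++ Δ ⊢ γ₁ ++ δ ++ γ₂ ∶ C

hypVars : ∀ {Γ α A} → Γ ⊢ α ∶ A → List ℕ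
hypVars (hyp {α = α} _ _) = vars α
hypVars (perm _ d)        = hypVars d
hypVars (⧹E d e)          = hypVars d ++ hypVars e
hypVars (⧹I d)            = hypVars d
hypVars (⧸E d e)          = hypVars d ++ hypVars e
hypVars (⧸I d)            = hypVars d
hypVars (•I d e)          = hypVars d ++ hypVars e
hypVars (•E d e)          = hypVars d ++ hypVars e
hypVars (↓E _ d e)        = hypVars d ++ hypVars e
hypVars (↓I _ d)          = hypVars d
hypVars (↑E _ d e)        = hypVars d ++ hypVars e
hypVars (↑I _ d)          = hypVars d
hypVars (⊙I _ d e)        = hypVars d ++ hypVars e
hypVars (⊙E _ d e)        = hypVars d ++ hypVars e

Fresh : ∀ {Γ α A} → Γ ⊢ α ∶ A → Set
Fresh d = Unique (hypVars d)

data LinkKind : Set where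
  -- tensor links
  Lover Lunder Rprod : LinkKind
  Lextr Linfix Rwprod : Mode → LinkKind
  -- par links
  Lprod : LinkKind                           -- [L•]  A•B main → A , B
  Lwprod : Mode → LinkKind                   -- [L⊙]  A⊙B main → A , B
  Rover Runder : LinkKind                    -- [R/] C → C/B main , B ; [R\] C → A , A\C main
  Rextr Rinfix : Mode → LinkKind             -- [R↑] C → C↑B main , B ; [R↓] C → A , A↓C main

record Link : Set where
  constructor link
  field
    kind  : LinkKind
    prem  : List ℕ
    concl : List ℕ

record PS : Set where
  constructor ps
  field
    verts : List (ℕ × Formula)
    links : List Link

IsHyp : PS → ℕ → Set
IsHyp P v = v ∈ map proj₁ (PS.verts P) × ¬ Any (λ l → v ∈ Link.concl l) (PS.links P)

IsConcl : PS → ℕ → Set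
IsConcl P v = v ∈ map proj₁ (PS.verts P) × ¬ Any (λ l → v ∈ Link.prem l) (PS.links P)

-- The proof structure of a natural deduction proof (vertices numbered
-- from a counter); records the vertex of every open hypothesis and the root.

record TOut (Γ : Ctx) : Set where
  constructor tout
  field
    nxt   : ℕ
    vs    : List (ℕ × Formula)
    ls    : List Link
    hv    : All (λ _ → ℕ) Γ
    root  : ℕ

tens2 : ∀ {Γ Δ} → LinkKind → Formula → TOut Γ → TOut Δ → TOut (Γ ++ Δ)
tens2 K R (tout _ vs₁ ls₁ hv₁ r₁) (tout m vs₂ ls₂ hv₂ r₂) =
    tout (suc m) ((m , R) ∷ vs₁ ++ vs₂)
         (link K (r₁ ∷ r₂ ∷ []) (m ∷ []) ∷ ls₁ ++ ls₂) (++⁺ hv₁ hv₂) m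

-- par link introducing a new main conclusion, discharging the first
-- hypothesis; auxFirst says whether the auxiliary conclusion comes first
parI : ∀ {x Γ} → LinkKind → (auxFirst : Bool) → Formula → TOut (x ∷ Γ) → TOut Γ
parI K af R (tout m vs ls (h ∷ hs) r) =
  tout (suc m) ((m , R) ∷ vs) (link K (r ∷ []) (order af h m) ∷ ls) hs m
  where
    order : Bool → ℕ → ℕ → List ℕ
    order true h m = h ∷ m ∷ []
    order false h m = m ∷ h ∷ []

parE : ∀ {Γ a b Δ} → LinkKind → TOut Γ → TOut (a ∷ b ∷ Δ) → TOut (Γ ++ Δ)
parE K (tout _ vs₁ ls₁ hv₁ r₁) (tout m vs₂ ls₂ (ha ∷ hb ∷ hs) r₂) =
  tout m (vs₁ ++ vs₂) (link K (r₁ ∷ []) (ha ∷ hb ∷ []) ∷ ls₁ ++ ls₂) (++⁺ hv₁ hs) r₂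

translate : ∀ {Γ α A} → ℕ → Γ ⊢ α ∶ A → TOut Γ
translate n (hyp {A = A} _ _) = tout (suc n) ((n , A) ∷ []) [] (n ∷ []) n
translate n (perm p d) with translate n d
... | tout m vs ls hv r = tout m vs ls (All-resp-↭ p hv) r
translate n (⧹E {A = A} {C = C} d e) =
  let t = translate n d in tens2 Lunder C t (translate (TOut.nxt t) e)
translate n (⧹I {A = A} {C = C} d) = parI Runder true (A ⧹ C) (translate n d)
translate n (⧸E {C = C} d e) =
  let t = translate n d in tens2 Lover C t (translate (TOut.nxt t) e)
translate n (⧸I {B = B} {C = C} d) = parI Rover false (C ⧸ B) (translate n d)
translate n (•I {A = A} {B = B} d e) =
  let t = translate n d in tens2 Rprod (A • B) t (translate (TOut.nxt t) e)
translate n (•E d e) =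
  let t = translate n d in parE Lprod t (translate (TOut.nxt t) e)
translate n (↓E {k = k} {C = C} _ d e) =
  let t = translate n d in tens2 (Linfix k) C t (translate (TOut.nxt t) e)
translate n (↓I {k = k} {A = A} {C = C} _ d) = parI (Rinfix k) true (A ↓[ k ] C) (translate n d)
translate n (↑E {k = k} {C = C} _ d e) =
  let t = translate n d in tens2 (Lextr k) C t (translate (TOut.nxt t) e)
translate n (↑I {k = k} {B = B} {C = C} _ d) = parI (Rextr k) false (C ↑[ k ] B) (translate n d)
translate n (⊙I {k = k} {A = A} {B = B} _ d e) =
  let t = translate n d in tens2 (Rwprod k) (A ⊙[ k ] B) t (translate (TOut.nxt t) e)
translate n (⊙E {k = k} _ d e) =
  let t = translate n d in parE (Lwprod k) t (translate (TOut.nxt t) e)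

netOf : ∀ {Γ α A} → Γ ⊢ α ∶ A → PS
netOf d = ps (TOut.vs t) (TOut.ls t) where t = translate 0 d

IsProofNet : PS → Set
IsProofNet P = Σ Ctx λ Γ → Σ Str λ α → Σ Formula λ A →
               Σ (Γ ⊢ α ∶ A) λ d → Fresh d × netOf d ≡ P

-- vertices: original vertices, string variables p, and the new vertices
-- w h i  (i-th piece of the split auxiliary input h)
data AV : Set where
  orig : ℕ → AV
  pv   : ℕ → AV
  wv   : ℕ → ℕ → AV

data Prem : Set where
  vx : AV → Prem
  𝟏ᵖ : Prem

data ALink : Set where
  comb : List Prem → AV → ALink                    -- premisses → conclusion
  tens : Mode → AV → AV → AV → ALink               -- ×_k link v₁ , v₂ → v₃
  -- par links, auxiliary input replaced by w₀ … wₙ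
  p⧹   : AV → List AV → AV → ALink                 -- premiss, ws, main
  p⧸   : AV → List AV → AV → ALink
  p↑   : Mode → AV → List AV → AV → ALink
  p↓   : Mode → AV → List AV → AV → ALink
  p•   : AV → List AV → List AV → ALink            -- main premiss, W_A, W_B
  p⊙   : Mode → AV → List AV → List AV → ALink

Wp : List AV → List Prem
Wp []           = []
Wp (w ∷ [])     = vx w ∷ []
Wp (w ∷ w′ ∷ ws) = vx w ∷ 𝟏ᵖ ∷ Wp (w′ ∷ ws)

toPrem : Sym → Prem
toPrem (var x) = vx (pv x)
toPrem 𝟏       = 𝟏ᵖ

lookupF : List (ℕ × Formula) → ℕ → Maybe Formula
lookupF [] v = nothing
lookupF ((u , A) ∷ vs) v with u Data.Nat.≟ v
... | Relation.Nullary.yes _ = just A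
... | Relation.Nullary.no _  = lookupF vs v

asort : PS → AV → ℕ
asort P (orig v) = maybe sort 0 (lookupF (PS.verts P) v)
asort P (pv _)   = 0
asort P (wv _ _) = 0

psort : (AV → ℕ) → List Prem → ℕ
psort s []          = 0
psort s (vx u ∷ qs) = s u + psort s qs
psort s (𝟏ᵖ ∷ qs)   = suc (psort s qs)

PSepPos : (AV → ℕ) → Mode → List Prem → List Prem → Set
PSepPos s first   α₁ α₂ = psort s α₁ ≡ 0
PSepPos s last    α₁ α₂ = psort s α₂ ≡ 0
PSepPos s (nth n) α₁ α₂ = suc (psort s α₁) ≡ n

module _ (P : PS) where
  private
    ws : ℕ → List AV
    ws h = map (wv h) (upTo (suc (asort P (orig h))))

    auxComb : ℕ → ALink
    auxComb h = comb (Wp (ws h)) (orig h)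

  convLink : Link → List ALink
  convLink (link Lover (c ∷ b ∷ []) (x ∷ [])) = comb (vx (orig c) ∷ vx (orig b) ∷ []) (orig x) ∷ []
  convLink (link Lunder (a ∷ f ∷ []) (x ∷ [])) = comb (vx (orig a) ∷ vx (orig f) ∷ []) (orig x) ∷ []
  convLink (link Rprod (a ∷ b ∷ []) (x ∷ [])) = comb (vx (orig a) ∷ vx (orig b) ∷ []) (orig x) ∷ []
  convLink (link (Lextr k) (f ∷ b ∷ []) (x ∷ [])) = tens k (orig f) (orig b) (orig x) ∷ []
  convLink (link (Linfix k) (a ∷ f ∷ []) (x ∷ [])) = tens k (orig a) (orig f) (orig x) ∷ []
  convLink (link (Rwprod k) (a ∷ b ∷ []) (x ∷ [])) = tens k (orig a) (orig b) (orig x) ∷ []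
  convLink (link Lprod (m ∷ []) (a ∷ b ∷ [])) = p• (orig m) (ws a) (ws b) ∷ auxComb a ∷ auxComb b ∷ []
  convLink (link (Lwprod k) (m ∷ []) (a ∷ b ∷ [])) = p⊙ k (orig m) (ws a) (ws b) ∷ auxComb a ∷ auxComb b ∷ []
  convLink (link Rover (c ∷ []) (m ∷ b ∷ [])) = p⧸ (orig c) (ws b) (orig m) ∷ auxComb b ∷ []
  convLink (link Runder (c ∷ []) (a ∷ m ∷ [])) = p⧹ (orig c) (ws a) (orig m) ∷ auxComb a ∷ []
  convLink (link (Rextr k) (c ∷ []) (m ∷ b ∷ [])) = p↑ k (orig c) (ws b) (orig m) ∷ auxComb b ∷ []
  convLink (link (Rinfix k) (c ∷ []) (a ∷ m ∷ [])) = p↓ k (orig c) (ws a) (orig m) ∷ auxComb a ∷ []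
  convLink _ = []   -- ill-shaped links do not occur in proof structures

  -- the abstract proof structure, given the strings of the hypotheses
  abstractPS : List (ℕ × Str) → List ALink
  abstractPS hs = concatMap convLink (PS.links P)
                  ++ map (λ { (h , α) → comb (map toPrem α) (orig h) }) hs

data Redex (s : AV → ℕ) : List ALink → List ALink → Set where
  r+  : ∀ {α₁ α₂ β u v} →
        Redex s (comb (α₁ ++ vx u ∷ α₂) v ∷ comb β u ∷ [])
                (comb (α₁ ++ β ++ α₂) v ∷ [])
  r×  : ∀ {k α₁ α₂ β u₁ u₂ v} → PSepPos s k α₁ α₂ →
        Redex s (tens k u₁ u₂ v ∷ comb (α₁ ++ 𝟏ᵖ ∷ α₂) u₁ ∷ comb β u₂ ∷ [])
                (comb (α₁ ++ β ++ α₂) v ∷ [])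
  r⧹  : ∀ {ws β u v} →
        Redex s (p⧹ u ws v ∷ comb (Wp ws ++ β) u ∷ []) (comb β v ∷ [])
  r⧸  : ∀ {ws β u v} →
        Redex s (p⧸ u ws v ∷ comb (β ++ Wp ws) u ∷ []) (comb β v ∷ [])
  r↑  : ∀ {k ws α₁ α₂ u v} → PSepPos s k α₁ α₂ →
        Redex s (p↑ k u ws v ∷ comb (α₁ ++ Wp ws ++ α₂) u ∷ [])
                (comb (α₁ ++ 𝟏ᵖ ∷ α₂) v ∷ [])
  r↓  : ∀ {k ws W₁ W₂ β u v} → Wp ws ≡ W₁ ++ 𝟏ᵖ ∷ W₂ → PSepPos s k W₁ W₂ →
        Redex s (p↓ k u ws v ∷ comb (W₁ ++ β ++ W₂) u ∷ []) (comb β v ∷ [])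
  r•  : ∀ {wa wb γ₁ γ₂ v₁ v₂} →
        Redex s (p• v₁ wa wb ∷ comb (γ₁ ++ Wp wa ++ Wp wb ++ γ₂) v₂ ∷ [])
                (comb (γ₁ ++ vx v₁ ∷ γ₂) v₂ ∷ [])
  r⊙  : ∀ {k wa wb α₁ α₂ γ₁ γ₂ v₁ v₂} → Wp wa ≡ α₁ ++ 𝟏ᵖ ∷ α₂ → PSepPos s k α₁ α₂ →
        Redex s (p⊙ k v₁ wa wb ∷ comb (γ₁ ++ α₁ ++ Wp wb ++ α₂ ++ γ₂) v₂ ∷ [])
                (comb (γ₁ ++ vx v₁ ∷ γ₂) v₂ ∷ [])

-- one contraction anywhere in the (unordered) structure
data Contract (s : AV → ℕ) (L M : List ALink) : Set where
  contract : ∀ {R R′ rest} → Redex s R R′ → L ↭ R ++ rest → M ↭ R′ ++ rest →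
             Contract s L M

Contracts : (AV → ℕ) → List ALink → List ALink → Set
Contracts s = Star (Contract s)

-- Its vertices are numbered
-- from a counter, so the translations of the premisses of a rule occupy disjoint ranges; by
-- induction this identifies the hypotheses of the structure with the vertices of the open
-- hypotheses of δ, and its only conclusion with the root.
--
-- For the contraction, let σ send every string variable to a list of sort-0 premisses and give
-- each open hypothesis (α , A) at vertex h the comb σ(α) → h.  By induction on δ, the combs of
-- the links together with these hypothesis combs contract to the single comb σ(γ) → root.  A
-- tensor link disappears in one [+] or [×ₖ] contraction of the two induction hypotheses.  At a
-- par link σ is changed to send the variables of the discharged hypothesis string, one by one,
-- onto the split auxiliary input w₀ , 𝟏 , … , 𝟏 , wₙ; then the hypothesis comb the induction
-- hypothesis asks for is exactly the comb of the auxiliary input, and the logical contraction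
-- fires.  Freshness and linearity of δ make those variables occur nowhere else, so the change
-- of σ does not disturb the rest of the term.  The theorem is the case σ x = x.

module Submission where

open import Defs
open import Data.Nat using (ℕ; zero; suc; _+_; _≤_; _<_; _≟_)
open import Data.Nat.Properties using (+-assoc; ≤-refl; ≤-trans; <-trans; <-≤-trans; n≤1+n; n<1+n; <⇒≱; <-irrefl)
open import Data.List using (List; []; _∷_; _++_; [_]; map; zip; concatMap; upTo; applyUpTo)
open import Data.List.Properties using (++-assoc; ++-identityʳ; ++-cancelˡ; map-++)
open import Data.List.Relation.Unary.All as All using (All; []; _∷_)
import Data.List.Relation.Unary.All.Properties as AllP
open import Data.List.Relation.Unary.Any using (Any; here; there)
import Data.List.Relation.Unary.Any.Properties as AnyP
open import Data.List.Relation.Unary.Unique.Propositional using (Unique; []; _∷_)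
import Data.List.Relation.Unary.Unique.Propositional.Properties as UniqueP
open import Data.List.Relation.Binary.Disjoint.Propositional using (Disjoint)
open import Data.List.Relation.Binary.Subset.Propositional using (_⊆_)
open import Data.List.Membership.Propositional using (_∈_; _∉_)
open import Data.List.Membership.Propositional.Properties using (∈-++⁺ˡ; ∈-++⁺ʳ; ∈-++⁻; ∈-map⁺)
open import Data.List.Relation.Binary.Pointwise using (Pointwise; []; _∷_)
open import Data.List.Relation.Binary.Permutation.Propositional as ↭
  using (_↭_; ↭-refl; ↭-sym; ↭-trans; ↭-reflexive; ↭-prep; ↭-swap; ↭⇒↭ₛ; module PermutationReasoning)
open import Data.List.Relation.Binary.Permutation.Propositional.Properties
  using (++⁺ˡ; ++⁺ʳ; shift; shifts; drop-∷; ↭-singleton-inv; ∈-resp-↭; All-resp-↭)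
  renaming (++⁺ to ↭-++⁺; ++-comm to ↭-++-comm)
import Data.List.Relation.Binary.Permutation.Setoid.Properties as ↭ₛ
open import Data.Product using (Σ; _×_; _,_; proj₁; proj₂; uncurry)
open import Data.Sum using (_⊎_; inj₁; inj₂; swap)
open import Data.Empty using (⊥-elim)
open import Data.Unit using (⊤; tt)
open import Data.Bool using (true; false)
open import Data.Maybe using (just)
open import Function.Base using (_∘_)
open import Function.Bundles using (_⇔_; mk⇔)
open import Relation.Nullary using (¬_; yes; no)
open import Relation.Binary.PropositionalEquality
  using (_≡_; _≢_; refl; sym; trans; cong; cong₂; subst; subst₂; setoid)
open import Relation.Binary.Construct.Closure.ReflexiveTransitive using (ε; _◅_; _◅◅_; gmap)

Unique-resp-↭ : ∀ {A : Set} {xs ys : List A} → xs ↭ ys → Unique xs → Unique ys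
Unique-resp-↭ {A} p = ↭ₛ.Unique-resp-↭ (setoid A) (↭⇒↭ₛ p)

Unique-++⁻ˡ : ∀ {A : Set} (xs : List A) {ys} → Unique (xs ++ ys) → Unique xs
Unique-++⁻ˡ []       _        = []
Unique-++⁻ˡ (x ∷ xs) (x∉ ∷ u) = AllP.++⁻ˡ xs x∉ ∷ Unique-++⁻ˡ xs u

Unique-++⁻ʳ : ∀ {A : Set} (xs : List A) {ys} → Unique (xs ++ ys) → Unique ys
Unique-++⁻ʳ []       u       = u
Unique-++⁻ʳ (x ∷ xs) (_ ∷ u) = Unique-++⁻ʳ xs u

Unique-++⇒Disjoint : ∀ {A : Set} (xs : List A) {ys} → Unique (xs ++ ys) → Disjoint xs ys
Unique-++⇒Disjoint (x ∷ xs) (x∉ ∷ _) (here refl , y∈ys) = All.lookup (AllP.++⁻ʳ xs x∉) y∈ys refl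
Unique-++⇒Disjoint (x ∷ xs) (_ ∷ u)  (there y∈xs , y∈ys) = Unique-++⇒Disjoint xs u (y∈xs , y∈ys)

↭-++-cancelˡ : ∀ {A : Set} (xs : List A) {ys zs} → xs ++ ys ↭ xs ++ zs → ys ↭ zs
↭-++-cancelˡ []       p = p
↭-++-cancelˡ (x ∷ xs) p = ↭-++-cancelˡ xs (drop-∷ p)

++-interchange-↭ : ∀ {A : Set} (as bs cs ds : List A) → (as ++ bs) ++ (cs ++ ds) ↭ (as ++ cs) ++ (bs ++ ds)
++-interchange-↭ as bs cs ds = begin
  (as ++ bs) ++ (cs ++ ds)   ≡⟨ ++-assoc as bs _ ⟩
  as ++ bs ++ cs ++ ds       ↭⟨ ++⁺ˡ as (shifts bs cs) ⟩
  as ++ cs ++ bs ++ ds       ≡⟨ ++-assoc as cs _ ⟨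
  (as ++ cs) ++ (bs ++ ds)   ∎
  where open PermutationReasoning

map-applyUpTo : ∀ {A B : Set} (g : A → B) (f : ℕ → A) n → map g (applyUpTo f n) ≡ applyUpTo (g ∘ f) n
map-applyUpTo g f zero    = refl
map-applyUpTo g f (suc n) = cong (g (f 0) ∷_) (map-applyUpTo g (f ∘ suc) n)

module UpToPermutation (s : AV → ℕ) where

  infix 4 _↠_

  -- Links form a set: L ↠ M says that L contracts to a reordering of M.
  _↠_ : List ALink → List ALink → Set
  L ↠ M = Σ (List ALink) λ M′ → Contracts s L M′ × M′ ↭ M

  ↭⇒↠ : ∀ {L M} → L ↭ M → L ↠ M
  ↭⇒↠ p = _ , ε , p

  Contract-respˡ-↭ : ∀ {L L′ M} → L′ ↭ L → Contract s L M → Contract s L′ M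
  Contract-respˡ-↭ p (contract r q₁ q₂) = contract r (↭-trans p q₁) q₂

  ↠-trans : ∀ {L M N} → L ↠ M → M ↠ N → L ↠ N
  ↠-trans (_ , cs , p) (_ , ε , q)        = _ , cs , ↭-trans p q
  ↠-trans (_ , cs , p) (_ , c ◅ cs′ , q) = _ , cs ◅◅ (Contract-respˡ-↭ p c ◅ cs′) , q

  Contract-++ʳ : ∀ K {L M} → Contract s L M → Contract s (L ++ K) (M ++ K)
  Contract-++ʳ K (contract {R} {R′} {rest} r p q) =
    contract r (↭-trans (++⁺ʳ K p) (↭-reflexive (++-assoc R rest K)))
               (↭-trans (++⁺ʳ K q) (↭-reflexive (++-assoc R′ rest K)))

  Contract-++ˡ : ∀ K {L M} → Contract s L M → Contract s (K ++ L) (K ++ M)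
  Contract-++ˡ K (contract {R} {R′} r p q) =
    contract r (↭-trans (++⁺ˡ K p) (shifts K R)) (↭-trans (++⁺ˡ K q) (shifts K R′))

  ↠-++ʳ : ∀ K {L M} → L ↠ M → L ++ K ↠ M ++ K
  ↠-++ʳ K (_ , cs , p) = _ , gmap (_++ K) (Contract-++ʳ K) cs , ++⁺ʳ K p

  ↠-++ˡ : ∀ K {L M} → L ↠ M → K ++ L ↠ K ++ M
  ↠-++ˡ K (_ , cs , p) = _ , gmap (K ++_) (Contract-++ˡ K) cs , ++⁺ˡ K p

  ↠-++ : ∀ {L M L′ M′} → L ↠ M → L′ ↠ M′ → L ++ L′ ↠ M ++ M′
  ↠-++ {M = M} {L′} p q = ↠-trans (↠-++ʳ L′ p) (↠-++ˡ M q)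

  Redex⇒↠ : ∀ {R R′} → Redex s R R′ → R ↠ R′
  Redex⇒↠ {R} {R′} r =
    _ , contract r (↭-reflexive (sym (++-identityʳ R))) (↭-reflexive (sym (++-identityʳ R′))) ◅ ε , ↭-refl

  ↠-comb-≡ : ∀ {L qs qs′ v} → qs ≡ qs′ → L ↠ [ comb qs v ] → L ↠ [ comb qs′ v ]
  ↠-comb-≡ refl y = y

  ↠-singleton⇒Contracts : ∀ {L x} → L ↠ [ x ] → Contracts s L [ x ]
  ↠-singleton⇒Contracts (_ , cs , p) with refl ← ↭-singleton-inv p = cs

  concat-↠ : ∀ {u₁ u₂ v α β} →
    comb (vx u₁ ∷ vx u₂ ∷ []) v ∷ comb α u₁ ∷ comb β u₂ ∷ [] ↠ [ comb (α ++ β) v ]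
  concat-↠ {u₂ = u₂} {v} {α} {β} =
    ↠-trans (↠-++ʳ [ comb β u₂ ] (Redex⇒↠ (r+ {α₁ = []} {α₂ = [ vx u₂ ]})))
      (↠-trans (Redex⇒↠ (r+ {α₁ = α} {α₂ = []}))
        (↭⇒↠ (↭-reflexive (cong (λ qs → [ comb qs v ]) (cong (α ++_) (++-identityʳ β))))))

-- Substituting premisses for string variables

Sub : Set
Sub = ℕ → List Prem

apply : Sub → Str → List Prem
apply σ []          = []
apply σ (var x ∷ s) = σ x ++ apply σ s
apply σ (𝟏 ∷ s)     = 𝟏ᵖ ∷ apply σ s

apply-++ : ∀ σ a b → apply σ (a ++ b) ≡ apply σ a ++ apply σ b
apply-++ σ []          b = refl
apply-++ σ (var x ∷ a) b = trans (cong (σ x ++_) (apply-++ σ a b)) (sym (++-assoc (σ x) _ _))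
apply-++ σ (𝟏 ∷ a)     b = cong (𝟏ᵖ ∷_) (apply-++ σ a b)

apply-++-++ : ∀ σ a b c → apply σ (a ++ b ++ c) ≡ apply σ a ++ apply σ b ++ apply σ c
apply-++-++ σ a b c = trans (apply-++ σ a (b ++ c)) (cong (apply σ a ++_) (apply-++ σ b c))

apply-cong : ∀ σ τ s → (∀ {x} → x ∈ vars s → σ x ≡ τ x) → apply σ s ≡ apply τ s
apply-cong σ τ []          eq = refl
apply-cong σ τ (var x ∷ s) eq = cong₂ _++_ (eq (here refl)) (apply-cong σ τ s (eq ∘ there))
apply-cong σ τ (𝟏 ∷ s)     eq = cong (𝟏ᵖ ∷_) (apply-cong σ τ s eq)

data IsVarPrem : Prem → Set where
  stringVar : ∀ x → IsVarPrem (vx (pv x))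
  inputVar  : ∀ h i → IsVarPrem (vx (wv h i))

VarSub : Sub → Set
VarSub σ = ∀ x → All IsVarPrem (σ x)

psort-++ : ∀ s a b → psort s (a ++ b) ≡ psort s a + psort s b
psort-++ s []         b = refl
psort-++ s (vx u ∷ a) b = trans (cong (s u +_) (psort-++ s a b)) (sym (+-assoc (s u) _ _))
psort-++ s (𝟏ᵖ ∷ a)   b = cong suc (psort-++ s a b)

psort-varPrems : ∀ P {qs} → All IsVarPrem qs → psort (asort P) qs ≡ 0
psort-varPrems P []                  = refl
psort-varPrems P (stringVar _ ∷ qs)  = psort-varPrems P qs
psort-varPrems P (inputVar _ _ ∷ qs) = psort-varPrems P qs

psort-apply : ∀ P {σ} → VarSub σ → ∀ a → psort (asort P) (apply σ a) ≡ seps a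
psort-apply P     vσ []          = refl
psort-apply P {σ} vσ (var x ∷ a) =
  trans (psort-++ (asort P) (σ x) (apply σ a)) (cong₂ _+_ (psort-varPrems P (vσ x)) (psort-apply P vσ a))
psort-apply P     vσ (𝟏 ∷ a)     = cong suc (psort-apply P vσ a)

SepPos⇒PSepPos : ∀ P {σ} → VarSub σ → ∀ k {a b} → SepPos k a b →
                 PSepPos (asort P) k (apply σ a) (apply σ b)
SepPos⇒PSepPos P vσ first   {a}     e = trans (psort-apply P vσ a) e
SepPos⇒PSepPos P vσ last    {b = b} e = trans (psort-apply P vσ b) e
SepPos⇒PSepPos P vσ (nth n) {a}     e = trans (cong suc (psort-apply P vσ a)) e

_[_≔_] : Sub → ℕ → List Prem → Sub
(σ [ x ≔ qs ]) y with y ≟ x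
... | yes _ = qs
... | no  _ = σ y

[≔]-hit : ∀ σ x qs → (σ [ x ≔ qs ]) x ≡ qs
[≔]-hit σ x qs with x ≟ x
... | yes _   = refl
... | no  x≢x = ⊥-elim (x≢x refl)

[≔]-miss : ∀ σ x qs {y} → y ≢ x → (σ [ x ≔ qs ]) y ≡ σ y
[≔]-miss σ x qs {y} y≢x with y ≟ x
... | yes y≡x = ⊥-elim (y≢x y≡x)
... | no  _   = refl

[≔]-VarSub : ∀ {σ qs} x → VarSub σ → All IsVarPrem qs → VarSub (σ [ x ≔ qs ])
[≔]-VarSub x vσ vqs y with y ≟ x
... | yes _ = vqs
... | no  _ = vσ y

assign : ∀ {α n} → Sub → (ℕ → AV) → HypLabel α n → Sub
assign σ f (base x)    = σ [ x ≔ [ vx (f 0) ] ]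
assign σ f (step x hl) = assign σ (f ∘ suc) hl [ x ≔ [ vx (f 0) ] ]

assign-VarSub : ∀ {α n σ} f (hl : HypLabel α n) → (∀ i → IsVarPrem (vx (f i))) → VarSub σ →
                VarSub (assign σ f hl)
assign-VarSub f (base x)    vf vσ = [≔]-VarSub x vσ (vf 0 ∷ [])
assign-VarSub f (step x hl) vf vσ = [≔]-VarSub x (assign-VarSub (f ∘ suc) hl (vf ∘ suc) vσ) (vf 0 ∷ [])

assign-outside : ∀ {α n} σ f (hl : HypLabel α n) {y} → y ∉ vars α → assign σ f hl y ≡ σ y
assign-outside σ f (base x)    y∉ = [≔]-miss σ x _ (y∉ ∘ here)
assign-outside σ f (step x hl) y∉ =
  trans ([≔]-miss _ x _ (y∉ ∘ here)) (assign-outside σ (f ∘ suc) hl (y∉ ∘ there))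

apply-assign-outside : ∀ {α n} σ f (hl : HypLabel α n) s → Disjoint (vars s) (vars α) →
                       apply (assign σ f hl) s ≡ apply σ s
apply-assign-outside σ f hl s disj =
  apply-cong _ σ s (λ y∈s → assign-outside σ f hl (λ y∈α → disj (y∈s , y∈α)))

apply-assign-label : ∀ {α n} σ f (hl : HypLabel α n) → Unique (vars α) →
                     apply (assign σ f hl) α ≡ Wp (applyUpTo f (suc n))
apply-assign-label σ f (base x)          _        = cong (_++ []) ([≔]-hit σ x _)
apply-assign-label σ f (step {α} x hl) (x∉ ∷ u) =
  cong₂ _++_ ([≔]-hit σ′ x _) (cong (𝟏ᵖ ∷_) (trans
    (apply-cong _ σ′ α (λ y∈α → [≔]-miss σ′ x _ (λ { refl → All.lookup x∉ y∈α refl })))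
    (apply-assign-label σ (f ∘ suc) hl u)))
  where σ′ = assign σ (f ∘ suc) hl

apply-assign₂-outside : ∀ {X Y m n} σ f g (hlX : HypLabel X m) (hlY : HypLabel Y n) s →
  Disjoint (vars s) (vars X ++ vars Y) → apply (assign (assign σ g hlY) f hlX) s ≡ apply σ s
apply-assign₂-outside {X} σ f g hlX hlY s disj =
  trans (apply-assign-outside _ f hlX s (λ (x∈s , x∈X) → disj (x∈s , ∈-++⁺ˡ x∈X)))
        (apply-assign-outside σ g hlY s (λ (x∈s , x∈Y) → disj (x∈s , ∈-++⁺ʳ (vars X) x∈Y)))

-- Linearity and freshness of derivations

vars-++ : ∀ a b → vars (a ++ b) ≡ vars a ++ vars b
vars-++ []          b = refl
vars-++ (var x ∷ a) b = cong (x ∷_) (vars-++ a b)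
vars-++ (𝟏 ∷ a)     b = vars-++ a b

vars-𝟏 : ∀ a b → vars (a ++ 𝟏 ∷ b) ≡ vars (a ++ b)
vars-𝟏 a b = trans (vars-++ a (𝟏 ∷ b)) (sym (vars-++ a b))

∈-vars-++⁺ˡ : ∀ a b {x} → x ∈ vars a → x ∈ vars (a ++ b)
∈-vars-++⁺ˡ a b x∈ = subst (_ ∈_) (sym (vars-++ a b)) (∈-++⁺ˡ x∈)

∈-vars-++⁺ʳ : ∀ a b {x} → x ∈ vars b → x ∈ vars (a ++ b)
∈-vars-++⁺ʳ a b x∈ = subst (_ ∈_) (sym (vars-++ a b)) (∈-++⁺ʳ (vars a) x∈)

vars-middle : ∀ a b c → vars (a ++ b ++ c) ↭ vars b ++ vars (a ++ c)
vars-middle a b c = begin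
  vars (a ++ b ++ c)          ≡⟨ trans (vars-++ a _) (cong (vars a ++_) (vars-++ b c)) ⟩
  vars a ++ vars b ++ vars c  ↭⟨ shifts (vars a) (vars b) ⟩
  vars b ++ vars a ++ vars c  ≡⟨ cong (vars b ++_) (vars-++ a c) ⟨
  vars b ++ vars (a ++ c)     ∎
  where open PermutationReasoning

vars-wrap : ∀ a b c → vars (a ++ b ++ c) ↭ vars (a ++ 𝟏 ∷ c) ++ vars b
vars-wrap a b c = begin
  vars (a ++ b ++ c)           ↭⟨ vars-middle a b c ⟩
  vars b ++ vars (a ++ c)      ↭⟨ ↭-++-comm (vars b) _ ⟩
  vars (a ++ c) ++ vars b      ≡⟨ cong (_++ vars b) (vars-𝟏 a c) ⟨
  vars (a ++ 𝟏 ∷ c) ++ vars b  ∎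
  where open PermutationReasoning

cancel-vars-middle : ∀ a b c {xs} → vars (a ++ b ++ c) ↭ vars b ++ xs → vars (a ++ c) ↭ xs
cancel-vars-middle a b c p = ↭-++-cancelˡ (vars b) (↭-trans (↭-sym (vars-middle a b c)) p)

cancel-vars-wrap : ∀ a b c {xs} → vars (a ++ b ++ c) ↭ vars (a ++ 𝟏 ∷ c) ++ xs → vars b ↭ xs
cancel-vars-wrap a b c {xs} p = ↭-++-cancelˡ (vars (a ++ 𝟏 ∷ c)) (begin
  vars (a ++ 𝟏 ∷ c) ++ vars b  ↭⟨ vars-wrap a b c ⟨
  vars (a ++ b ++ c)           ↭⟨ p ⟩
  vars (a ++ 𝟏 ∷ c) ++ xs      ∎)
  where open PermutationReasoning

ctxVars : Ctx → List ℕ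
ctxVars []            = []
ctxVars ((α , _) ∷ Γ) = vars α ++ ctxVars Γ

ctxVars-++ : ∀ Γ Δ → ctxVars (Γ ++ Δ) ≡ ctxVars Γ ++ ctxVars Δ
ctxVars-++ []            Δ = refl
ctxVars-++ ((α , _) ∷ Γ) Δ = trans (cong (vars α ++_) (ctxVars-++ Γ Δ)) (sym (++-assoc (vars α) _ _))

ctxVars-resp-↭ : ∀ {Γ Δ} → Γ ↭ Δ → ctxVars Γ ↭ ctxVars Δ
ctxVars-resp-↭ ↭.refl                     = ↭-refl
ctxVars-resp-↭ (↭.prep (α , _) p)         = ++⁺ˡ (vars α) (ctxVars-resp-↭ p)
ctxVars-resp-↭ (↭.swap (α , _) (β , _) p) =
  ↭-trans (shifts (vars α) (vars β)) (++⁺ˡ (vars β) (++⁺ˡ (vars α) (ctxVars-resp-↭ p)))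
ctxVars-resp-↭ (↭.trans p q)              = ↭-trans (ctxVars-resp-↭ p) (ctxVars-resp-↭ q)

++-linear : ∀ Γ Δ a b → vars a ↭ ctxVars Γ → vars b ↭ ctxVars Δ → vars (a ++ b) ↭ ctxVars (Γ ++ Δ)
++-linear Γ Δ a b p q = begin
  vars (a ++ b)           ≡⟨ vars-++ a b ⟩
  vars a ++ vars b        ↭⟨ ↭-++⁺ p q ⟩
  ctxVars Γ ++ ctxVars Δ  ≡⟨ ctxVars-++ Γ Δ ⟨
  ctxVars (Γ ++ Δ)        ∎
  where open PermutationReasoning

wrap-linear : ∀ Γ Δ a b c → vars (a ++ 𝟏 ∷ c) ↭ ctxVars Γ → vars b ↭ ctxVars Δ →
              vars (a ++ b ++ c) ↭ ctxVars (Γ ++ Δ)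
wrap-linear Γ Δ a b c p q = begin
  vars (a ++ b ++ c)           ↭⟨ vars-wrap a b c ⟩
  vars (a ++ 𝟏 ∷ c) ++ vars b  ↭⟨ ↭-++⁺ p q ⟩
  ctxVars Γ ++ ctxVars Δ       ≡⟨ ctxVars-++ Γ Δ ⟨
  ctxVars (Γ ++ Δ)             ∎
  where open PermutationReasoning

frame-linear : ∀ Γ Δ a b c → vars b ↭ ctxVars Γ → vars (a ++ c) ↭ ctxVars Δ →
               vars (a ++ b ++ c) ↭ ctxVars (Γ ++ Δ)
frame-linear Γ Δ a b c p q = begin
  vars (a ++ b ++ c)       ↭⟨ vars-middle a b c ⟩
  vars b ++ vars (a ++ c)  ↭⟨ ↭-++⁺ p q ⟩
  ctxVars Γ ++ ctxVars Δ   ≡⟨ ctxVars-++ Γ Δ ⟨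
  ctxVars (Γ ++ Δ)         ∎
  where open PermutationReasoning

⊢-linear : ∀ {Γ γ C} → Γ ⊢ γ ∶ C → vars γ ↭ ctxVars Γ
⊢-linear (hyp {α} _ _)               = ↭-reflexive (sym (++-identityʳ (vars α)))
⊢-linear (perm p d)                  = ↭-trans (⊢-linear d) (ctxVars-resp-↭ p)
⊢-linear (⧹E {Γ} {Δ} {α} {γ} d e)   = ++-linear Γ Δ α γ (⊢-linear d) (⊢-linear e)
⊢-linear (⧸E {Γ} {Δ} {γ} {β} d e)   = ++-linear Γ Δ γ β (⊢-linear d) (⊢-linear e)
⊢-linear (•I {Γ} {Δ} {α} {β} d e)   = ++-linear Γ Δ α β (⊢-linear d) (⊢-linear e)
⊢-linear (↓E {Γ} {Δ} {_} {a} {α} {γ} _ d e) = wrap-linear Γ Δ a γ α (⊢-linear d) (⊢-linear e)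
⊢-linear (↑E {Γ} {Δ} {_} {c} {γ} {β} _ d e) = wrap-linear Γ Δ c β γ (⊢-linear d) (⊢-linear e)
⊢-linear (⊙I {Γ} {Δ} {_} {a} {α} {β} _ d e) = wrap-linear Γ Δ a β α (⊢-linear d) (⊢-linear e)
⊢-linear (⧹I {α = α} {γ} d)          = cancel-vars-middle [] α γ (⊢-linear d)
⊢-linear (⧸I {γ = γ} {β} d)          =
  ↭-++-cancelˡ (vars β) (↭-trans (↭-++-comm (vars β) (vars γ))
    (↭-trans (↭-reflexive (sym (vars-++ γ β))) (⊢-linear d)))
⊢-linear (↓I {a = a} {α} {γ} _ d)    = cancel-vars-wrap a γ α (⊢-linear d)
⊢-linear (↑I {c = c} {γ} {β} _ d)    = ↭-trans (↭-reflexive (vars-𝟏 c γ)) (cancel-vars-middle c β γ (⊢-linear d))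
⊢-linear (•E {Γ} {Δ} {δ} {α} {β} {γ₁} {γ₂} d e) =
  frame-linear Γ Δ γ₁ δ γ₂ (⊢-linear d) (cancel-vars-middle γ₁ (α ++ β) γ₂ (begin
    vars (γ₁ ++ (α ++ β) ++ γ₂)    ≡⟨ cong (λ s → vars (γ₁ ++ s)) (++-assoc α β γ₂) ⟩
    vars (γ₁ ++ α ++ β ++ γ₂)      ↭⟨ ⊢-linear e ⟩
    vars α ++ vars β ++ ctxVars Δ  ≡⟨ ++-assoc (vars α) (vars β) _ ⟨
    (vars α ++ vars β) ++ ctxVars Δ ≡⟨ cong (_++ ctxVars Δ) (vars-++ α β) ⟨
    vars (α ++ β) ++ ctxVars Δ     ∎))
  where open PermutationReasoning
⊢-linear (⊙E {Γ} {Δ} {δ = δ} {a} {α} {β} {γ₁} {γ₂} _ d e) =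
  frame-linear Γ Δ γ₁ δ γ₂ (⊢-linear d) (cancel-vars-middle γ₁ (a ++ β ++ α) γ₂ (begin
    vars (γ₁ ++ (a ++ β ++ α) ++ γ₂)          ≡⟨ cong (λ s → vars (γ₁ ++ s)) (reassoc a β α γ₂) ⟩
    vars (γ₁ ++ a ++ β ++ α ++ γ₂)            ↭⟨ ⊢-linear e ⟩
    vars (a ++ 𝟏 ∷ α) ++ vars β ++ ctxVars Δ  ≡⟨ ++-assoc (vars (a ++ 𝟏 ∷ α)) (vars β) _ ⟨
    (vars (a ++ 𝟏 ∷ α) ++ vars β) ++ ctxVars Δ ↭⟨ ++⁺ʳ (ctxVars Δ) (vars-wrap a β α) ⟨
    vars (a ++ β ++ α) ++ ctxVars Δ           ∎))
  where
    open PermutationReasoning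
    reassoc : ∀ (p q r t : Str) → (p ++ q ++ r) ++ t ≡ p ++ q ++ r ++ t
    reassoc p q r t = trans (++-assoc p (q ++ r) t) (cong (p ++_) (++-assoc q r t))

ctxVars-++-⊆ : ∀ Γ Δ {xs ys} → ctxVars Γ ⊆ xs → ctxVars Δ ⊆ ys → ctxVars (Γ ++ Δ) ⊆ xs ++ ys
ctxVars-++-⊆ Γ Δ p q x∈ with ∈-++⁻ (ctxVars Γ) (subst (_ ∈_) (ctxVars-++ Γ Δ) x∈)
... | inj₁ x∈Γ = ∈-++⁺ˡ (p x∈Γ)
... | inj₂ x∈Δ = ∈-++⁺ʳ _ (q x∈Δ)

ctxVars⊆hypVars : ∀ {Γ γ C} (d : Γ ⊢ γ ∶ C) → ctxVars Γ ⊆ hypVars d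
ctxVars⊆hypVars (hyp _ _)          = subst (_ ∈_) (++-identityʳ _)
ctxVars⊆hypVars (perm p d)         = ctxVars⊆hypVars d ∘ ∈-resp-↭ (↭-sym (ctxVars-resp-↭ p))
ctxVars⊆hypVars (⧹E {Γ} {Δ} d e)   = ctxVars-++-⊆ Γ Δ (ctxVars⊆hypVars d) (ctxVars⊆hypVars e)
ctxVars⊆hypVars (⧸E {Γ} {Δ} d e)   = ctxVars-++-⊆ Γ Δ (ctxVars⊆hypVars d) (ctxVars⊆hypVars e)
ctxVars⊆hypVars (•I {Γ} {Δ} d e)   = ctxVars-++-⊆ Γ Δ (ctxVars⊆hypVars d) (ctxVars⊆hypVars e)
ctxVars⊆hypVars (↓E {Γ} {Δ} _ d e) = ctxVars-++-⊆ Γ Δ (ctxVars⊆hypVars d) (ctxVars⊆hypVars e)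
ctxVars⊆hypVars (↑E {Γ} {Δ} _ d e) = ctxVars-++-⊆ Γ Δ (ctxVars⊆hypVars d) (ctxVars⊆hypVars e)
ctxVars⊆hypVars (⊙I {Γ} {Δ} _ d e) = ctxVars-++-⊆ Γ Δ (ctxVars⊆hypVars d) (ctxVars⊆hypVars e)
ctxVars⊆hypVars (⧹I d)             = ctxVars⊆hypVars d ∘ ∈-++⁺ʳ _
ctxVars⊆hypVars (⧸I d)             = ctxVars⊆hypVars d ∘ ∈-++⁺ʳ _
ctxVars⊆hypVars (↓I _ d)           = ctxVars⊆hypVars d ∘ ∈-++⁺ʳ _
ctxVars⊆hypVars (↑I _ d)           = ctxVars⊆hypVars d ∘ ∈-++⁺ʳ _
ctxVars⊆hypVars (•E {Γ} {Δ} {α = α} {β} d e) =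
  ctxVars-++-⊆ Γ Δ (ctxVars⊆hypVars d) (ctxVars⊆hypVars e ∘ ∈-++⁺ʳ (vars α) ∘ ∈-++⁺ʳ (vars β))
ctxVars⊆hypVars (⊙E {Γ} {Δ} {a = a} {α} {β} _ d e) =
  ctxVars-++-⊆ Γ Δ (ctxVars⊆hypVars d) (ctxVars⊆hypVars e ∘ ∈-++⁺ʳ (vars (a ++ 𝟏 ∷ α)) ∘ ∈-++⁺ʳ (vars β))

Fresh⇒Unique-ctxVars : ∀ {Γ γ C} (d : Γ ⊢ γ ∶ C) → Fresh d → Unique (ctxVars Γ)
Unique-ctxVars-++ : ∀ {Γ Δ γ δ A B} (d : Γ ⊢ γ ∶ A) (e : Δ ⊢ δ ∶ B) →
  Unique (hypVars d ++ hypVars e) → Unique (ctxVars (Γ ++ Δ))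
Unique-ctxVars-++ᵉ : ∀ {Γ Δ γ δ A B X Y A′ B′} (d : Γ ⊢ γ ∶ A) (e : (X , A′) ∷ (Y , B′) ∷ Δ ⊢ δ ∶ B) →
  Unique (hypVars d ++ hypVars e) → Unique (ctxVars (Γ ++ Δ))

Fresh⇒Unique-ctxVars (hyp _ _)   u = subst Unique (sym (++-identityʳ _)) u
Fresh⇒Unique-ctxVars (perm p d)  u = Unique-resp-↭ (ctxVars-resp-↭ p) (Fresh⇒Unique-ctxVars d u)
Fresh⇒Unique-ctxVars (⧹E d e)    u = Unique-ctxVars-++ d e u
Fresh⇒Unique-ctxVars (⧸E d e)    u = Unique-ctxVars-++ d e u
Fresh⇒Unique-ctxVars (•I d e)    u = Unique-ctxVars-++ d e u
Fresh⇒Unique-ctxVars (↓E _ d e)  u = Unique-ctxVars-++ d e u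
Fresh⇒Unique-ctxVars (↑E _ d e)  u = Unique-ctxVars-++ d e u
Fresh⇒Unique-ctxVars (⊙I _ d e)  u = Unique-ctxVars-++ d e u
Fresh⇒Unique-ctxVars (⧹I {α = X} d)           u = Unique-++⁻ʳ (vars X) (Fresh⇒Unique-ctxVars d u)
Fresh⇒Unique-ctxVars (⧸I {β = X} d)           u = Unique-++⁻ʳ (vars X) (Fresh⇒Unique-ctxVars d u)
Fresh⇒Unique-ctxVars (↓I {a = a} {α} _ d)     u = Unique-++⁻ʳ (vars (a ++ 𝟏 ∷ α)) (Fresh⇒Unique-ctxVars d u)
Fresh⇒Unique-ctxVars (↑I {β = X} _ d)         u = Unique-++⁻ʳ (vars X) (Fresh⇒Unique-ctxVars d u)
Fresh⇒Unique-ctxVars (•E d e)    u = Unique-ctxVars-++ᵉ d e u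
Fresh⇒Unique-ctxVars (⊙E _ d e)  u = Unique-ctxVars-++ᵉ d e u

Unique-ctxVars-++ {Γ} {Δ} d e u =
  subst Unique (sym (ctxVars-++ Γ Δ)) (UniqueP.++⁺
    (Fresh⇒Unique-ctxVars d (Unique-++⁻ˡ _ u)) (Fresh⇒Unique-ctxVars e (Unique-++⁻ʳ (hypVars d) u))
    (λ (x∈Γ , x∈Δ) → Unique-++⇒Disjoint _ u (ctxVars⊆hypVars d x∈Γ , ctxVars⊆hypVars e x∈Δ)))

Unique-ctxVars-++ᵉ {Γ} {Δ} {X = X} {Y} d e u =
  subst Unique (sym (ctxVars-++ Γ Δ)) (UniqueP.++⁺
    (Fresh⇒Unique-ctxVars d (Unique-++⁻ˡ _ u))
    (Unique-++⁻ʳ (vars Y) (Unique-++⁻ʳ (vars X) (Fresh⇒Unique-ctxVars e (Unique-++⁻ʳ (hypVars d) u))))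
    (λ (x∈Γ , x∈Δ) → Unique-++⇒Disjoint _ u
      (ctxVars⊆hypVars d x∈Γ , ctxVars⊆hypVars e (∈-++⁺ʳ (vars X) (∈-++⁺ʳ (vars Y) x∈Δ)))))

Fresh⇒Unique-vars : ∀ {Γ γ C} (d : Γ ⊢ γ ∶ C) → Fresh d → Unique (vars γ)
Fresh⇒Unique-vars d u = Unique-resp-↭ (↭-sym (⊢-linear d)) (Fresh⇒Unique-ctxVars d u)

Unique-vars-++⇒Disjoint : ∀ a b → Unique (vars (a ++ b)) → Disjoint (vars a) (vars b)
Unique-vars-++⇒Disjoint a b u = Unique-++⇒Disjoint (vars a) (subst Unique (vars-++ a b) u)

Unique-vars-middle : ∀ a b c → Unique (vars (a ++ b ++ c)) → Disjoint (vars b) (vars (a ++ c))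
Unique-vars-middle a b c u = Unique-++⇒Disjoint (vars b) (Unique-resp-↭ (vars-middle a b c) u)

Unique-vars-frame : ∀ a b c → Unique (vars (a ++ b ++ c)) →
                    Disjoint (vars a) (vars b) × Disjoint (vars c) (vars b)
Unique-vars-frame a b c u =
  (λ (x∈a , x∈b) → apart (x∈b , ∈-vars-++⁺ˡ a c x∈a)) , (λ (x∈c , x∈b) → apart (x∈b , ∈-vars-++⁺ʳ a c x∈c))
  where apart = Unique-vars-middle a b c u

-- Invariants of the translation into proof structures

hypVertices : ∀ {Γ : Ctx} → All (λ _ → ℕ) Γ → List ℕ
hypVertices []       = []
hypVertices (h ∷ hv) = h ∷ hypVertices hv

hypVertices-++ : ∀ {Γ Δ : Ctx} (hv₁ : All (λ _ → ℕ) Γ) (hv₂ : All (λ _ → ℕ) Δ) →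
                 hypVertices (AllP.++⁺ hv₁ hv₂) ≡ hypVertices hv₁ ++ hypVertices hv₂
hypVertices-++ []        hv₂ = refl
hypVertices-++ (h ∷ hv₁) hv₂ = cong (h ∷_) (hypVertices-++ hv₁ hv₂)

∈-hypVertices-++⁻ : ∀ {Γ Δ : Ctx} (hv₁ : All (λ _ → ℕ) Γ) (hv₂ : All (λ _ → ℕ) Δ) {v} →
  v ∈ hypVertices (AllP.++⁺ hv₁ hv₂) → v ∈ hypVertices hv₁ ⊎ v ∈ hypVertices hv₂
∈-hypVertices-++⁻ hv₁ hv₂ v∈ = ∈-++⁻ (hypVertices hv₁) (subst (_ ∈_) (hypVertices-++ hv₁ hv₂) v∈)

∈-hypVertices-++⁺ˡ : ∀ {Γ Δ : Ctx} (hv₁ : All (λ _ → ℕ) Γ) (hv₂ : All (λ _ → ℕ) Δ) {v} →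
  v ∈ hypVertices hv₁ → v ∈ hypVertices (AllP.++⁺ hv₁ hv₂)
∈-hypVertices-++⁺ˡ hv₁ hv₂ v∈ = subst (_ ∈_) (sym (hypVertices-++ hv₁ hv₂)) (∈-++⁺ˡ v∈)

∈-hypVertices-++⁺ʳ : ∀ {Γ Δ : Ctx} (hv₁ : All (λ _ → ℕ) Γ) (hv₂ : All (λ _ → ℕ) Δ) {v} →
  v ∈ hypVertices hv₂ → v ∈ hypVertices (AllP.++⁺ hv₁ hv₂)
∈-hypVertices-++⁺ʳ hv₁ hv₂ v∈ = subst (_ ∈_) (sym (hypVertices-++ hv₁ hv₂)) (∈-++⁺ʳ (hypVertices hv₁) v∈)

hypVertices-resp-↭ : ∀ {Γ Δ} (p : Γ ↭ Δ) (hv : All (λ _ → ℕ) Γ) →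
                     hypVertices (All-resp-↭ p hv) ↭ hypVertices hv
hypVertices-resp-↭ ↭.refl         hv            = ↭-refl
hypVertices-resp-↭ (↭.prep _ p)   (h ∷ hv)      = ↭-prep h (hypVertices-resp-↭ p hv)
hypVertices-resp-↭ (↭.swap _ _ p) (h ∷ h′ ∷ hv) = ↭-swap h′ h (hypVertices-resp-↭ p hv)
hypVertices-resp-↭ (↭.trans p q)  hv            = ↭-trans (hypVertices-resp-↭ q _) (hypVertices-resp-↭ p hv)

vertexIds : List (ℕ × Formula) → List ℕ
vertexIds = map proj₁

∈-vertexIds-++⁻ : ∀ xs ys {v} → v ∈ vertexIds (xs ++ ys) → v ∈ vertexIds xs ⊎ v ∈ vertexIds ys
∈-vertexIds-++⁻ xs ys v∈ = ∈-++⁻ (vertexIds xs) (subst (_ ∈_) (map-++ proj₁ xs ys) v∈)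

∈-vertexIds-++⁺ˡ : ∀ xs ys {v} → v ∈ vertexIds xs → v ∈ vertexIds (xs ++ ys)
∈-vertexIds-++⁺ˡ xs ys v∈ = subst (_ ∈_) (sym (map-++ proj₁ xs ys)) (∈-++⁺ˡ v∈)

∈-vertexIds-++⁺ʳ : ∀ xs ys {v} → v ∈ vertexIds ys → v ∈ vertexIds (xs ++ ys)
∈-vertexIds-++⁺ʳ xs ys v∈ = subst (_ ∈_) (sym (map-++ proj₁ xs ys)) (∈-++⁺ʳ (vertexIds xs) v∈)

PremOf ConclOf : List Link → ℕ → Set
PremOf  ls v = Any (λ l → v ∈ Link.prem l) ls
ConclOf ls v = Any (λ l → v ∈ Link.concl l) ls

Any-∷-++⁻ : ∀ {P : Link → Set} {l} ls₁ {ls₂} → Any P (l ∷ ls₁ ++ ls₂) → P l ⊎ Any P ls₁ ⊎ Any P ls₂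
Any-∷-++⁻ ls₁ (here p)  = inj₁ p
Any-∷-++⁻ ls₁ (there p) = inj₂ (AnyP.++⁻ ls₁ p)

∈-pair⁻ : ∀ {a b v : ℕ} → v ∈ a ∷ b ∷ [] → v ≡ a ⊎ v ≡ b
∈-pair⁻ (here v≡a)         = inj₁ v≡a
∈-pair⁻ (there (here v≡b)) = inj₂ v≡b

Labelled : (Γ : Ctx) → All (λ _ → ℕ) Γ → List (ℕ × Formula) → Set
Labelled []            []       _  = ⊤
Labelled ((α , A) ∷ Γ) (h ∷ hv) vs = ((h , A) ∈ vs × HypLabel α (sort A)) × Labelled Γ hv vs

Labelled-mono : ∀ {vs vs′} → (∀ {x} → x ∈ vs → x ∈ vs′) → ∀ Γ hv → Labelled Γ hv vs → Labelled Γ hv vs′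
Labelled-mono f []      []       tt             = tt
Labelled-mono f (_ ∷ Γ) (_ ∷ hv) ((h∈ , hl) , L) = (f h∈ , hl) , Labelled-mono f Γ hv L

Labelled-++ : ∀ {vs} Γ Δ hv₁ hv₂ → Labelled Γ hv₁ vs → Labelled Δ hv₂ vs →
              Labelled (Γ ++ Δ) (AllP.++⁺ hv₁ hv₂) vs
Labelled-++ []      Δ []        hv₂ tt       L₂ = L₂
Labelled-++ (_ ∷ Γ) Δ (_ ∷ hv₁) hv₂ (l , L₁) L₂ = l , Labelled-++ Γ Δ hv₁ hv₂ L₁ L₂

Labelled-resp-↭ : ∀ {vs Γ Δ} (p : Γ ↭ Δ) hv → Labelled Γ hv vs → Labelled Δ (All-resp-↭ p hv) vs
Labelled-resp-↭ ↭.refl         hv           L             = L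
Labelled-resp-↭ (↭.prep _ p)   (_ ∷ hv)     (l , L)       = l , Labelled-resp-↭ p hv L
Labelled-resp-↭ (↭.swap _ _ p) (_ ∷ _ ∷ hv) (l , l′ , L)  = l′ , l , Labelled-resp-↭ p hv L
Labelled-resp-↭ (↭.trans p q)  hv           L             = Labelled-resp-↭ q _ (Labelled-resp-↭ p hv L)

Labelled⇒⊆ : ∀ {vs} Γ hv → Labelled Γ hv vs → hypVertices hv ⊆ vertexIds vs
Labelled⇒⊆ (_ ∷ Γ) (_ ∷ hv) ((h∈ , _) , _) (here refl) = ∈-map⁺ proj₁ h∈
Labelled⇒⊆ (_ ∷ Γ) (_ ∷ hv) (_ , L)        (there v∈)  = Labelled⇒⊆ Γ hv L v∈

record Scoped {Γ} (n : ℕ) (C : Formula) (t : TOut Γ) : Set where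
  field
    start≤nxt  : n ≤ TOut.nxt t
    ids-range  : ∀ {v} → v ∈ vertexIds (TOut.vs t) → n ≤ v × v < TOut.nxt t
    ids-unique : Unique (vertexIds (TOut.vs t))
    root∈      : (TOut.root t , C) ∈ TOut.vs t
    prem∈      : ∀ {v} → PremOf (TOut.ls t) v → v ∈ vertexIds (TOut.vs t)
    concl∈     : ∀ {v} → ConclOf (TOut.ls t) v → v ∈ vertexIds (TOut.vs t)
    labelled   : Labelled Γ (TOut.hv t) (TOut.vs t)

  hyp∈ : ∀ {v} → v ∈ hypVertices (TOut.hv t) → v ∈ vertexIds (TOut.vs t)
  hyp∈ = Labelled⇒⊆ Γ (TOut.hv t) labelled

  root∈ids : TOut.root t ∈ vertexIds (TOut.vs t)
  root∈ids = ∈-map⁺ proj₁ root∈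

  <nxt : ∀ {v} → v ∈ vertexIds (TOut.vs t) → v < TOut.nxt t
  <nxt = proj₂ ∘ ids-range

record Boundary {Γ} (t : TOut Γ) : Set where
  field
    hyps-unique : Unique (hypVertices (TOut.hv t))
    hyp⇒¬concl  : ∀ {v} → v ∈ hypVertices (TOut.hv t) → ¬ ConclOf (TOut.ls t) v
    ¬concl⇒hyp  : ∀ {v} → v ∈ vertexIds (TOut.vs t) → ¬ ConclOf (TOut.ls t) v → v ∈ hypVertices (TOut.hv t)
    root-¬prem  : ¬ PremOf (TOut.ls t) (TOut.root t)
    ¬prem⇒root  : ∀ {v} → v ∈ vertexIds (TOut.vs t) → ¬ PremOf (TOut.ls t) v → v ≡ TOut.root t

module _ {Γ Δ n C₁ C₂} {t₁ : TOut Γ} {t₂ : TOut Δ}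
         (S₁ : Scoped n C₁ t₁) (S₂ : Scoped (TOut.nxt t₁) C₂ t₂) where

  private
    module S₁ = Scoped S₁
    module S₂ = Scoped S₂

  scoped-apart : Disjoint (vertexIds (TOut.vs t₁)) (vertexIds (TOut.vs t₂))
  scoped-apart (v∈₁ , v∈₂) = <⇒≱ (S₁.<nxt v∈₁) (proj₁ (S₂.ids-range v∈₂))

  scoped-joined-range : ∀ {v} → v ∈ vertexIds (TOut.vs t₁ ++ TOut.vs t₂) → n ≤ v × v < TOut.nxt t₂
  scoped-joined-range v∈ with ∈-vertexIds-++⁻ (TOut.vs t₁) (TOut.vs t₂) v∈
  ... | inj₁ v∈₁ = proj₁ (S₁.ids-range v∈₁) , <-≤-trans (S₁.<nxt v∈₁) S₂.start≤nxt
  ... | inj₂ v∈₂ = ≤-trans S₁.start≤nxt (proj₁ (S₂.ids-range v∈₂)) , S₂.<nxt v∈₂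

  scoped-joined-unique : Unique (vertexIds (TOut.vs t₁ ++ TOut.vs t₂))
  scoped-joined-unique = subst Unique (sym (map-++ proj₁ (TOut.vs t₁) _))
                           (UniqueP.++⁺ S₁.ids-unique S₂.ids-unique scoped-apart)

scoped-tens2 : ∀ {Γ Δ n C₁ C₂} K R (t₁ : TOut Γ) (t₂ : TOut Δ) →
  Scoped n C₁ t₁ → Scoped (TOut.nxt t₁) C₂ t₂ → Scoped n R (tens2 K R t₁ t₂)
scoped-tens2 {Γ} {Δ} K R (tout _ vs₁ ls₁ hv₁ r₁) (tout m vs₂ ls₂ hv₂ r₂) S₁ S₂ = record
  { start≤nxt  = ≤-trans (≤-trans S₁.start≤nxt S₂.start≤nxt) (n≤1+n m)
  ; ids-range  = λ { (here refl) → ≤-trans S₁.start≤nxt S₂.start≤nxt , n<1+n m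
                   ; (there v∈) → proj₁ (joined v∈) , <-trans (proj₂ (joined v∈)) (n<1+n m) }
  ; ids-unique = All.tabulate (λ v∈ m≡v → <-irrefl (sym m≡v) (proj₂ (joined v∈)))
                 ∷ scoped-joined-unique S₁ S₂
  ; root∈      = here refl
  ; prem∈      = prem∈
  ; concl∈     = concl∈
  ; labelled   = Labelled-++ Γ Δ hv₁ hv₂ (Labelled-mono (there ∘ ∈-++⁺ˡ) Γ hv₁ S₁.labelled)
                                        (Labelled-mono (there ∘ ∈-++⁺ʳ _) Δ hv₂ S₂.labelled)
  }
  where
    module S₁ = Scoped S₁
    module S₂ = Scoped S₂
    joined = scoped-joined-range S₁ S₂
    L = link K (r₁ ∷ r₂ ∷ []) (m ∷ [])

    prem∈ : ∀ {v} → PremOf (L ∷ ls₁ ++ ls₂) v → v ∈ m ∷ vertexIds (vs₁ ++ vs₂)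
    prem∈ p with Any-∷-++⁻ ls₁ p
    ... | inj₁ v∈ with ∈-pair⁻ v∈
    ...   | inj₁ refl = there (∈-vertexIds-++⁺ˡ vs₁ vs₂ S₁.root∈ids)
    ...   | inj₂ refl = there (∈-vertexIds-++⁺ʳ vs₁ vs₂ S₂.root∈ids)
    prem∈ p | inj₂ (inj₁ p₁) = there (∈-vertexIds-++⁺ˡ vs₁ vs₂ (S₁.prem∈ p₁))
    prem∈ p | inj₂ (inj₂ p₂) = there (∈-vertexIds-++⁺ʳ vs₁ vs₂ (S₂.prem∈ p₂))

    concl∈ : ∀ {v} → ConclOf (L ∷ ls₁ ++ ls₂) v → v ∈ m ∷ vertexIds (vs₁ ++ vs₂)
    concl∈ c with Any-∷-++⁻ ls₁ c
    ... | inj₁ (here refl) = here refl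
    ... | inj₂ (inj₁ c₁)   = there (∈-vertexIds-++⁺ˡ vs₁ vs₂ (S₁.concl∈ c₁))
    ... | inj₂ (inj₂ c₂)   = there (∈-vertexIds-++⁺ʳ vs₁ vs₂ (S₂.concl∈ c₂))

boundary-tens2 : ∀ {Γ Δ n C₁ C₂} K R (t₁ : TOut Γ) (t₂ : TOut Δ) →
  Scoped n C₁ t₁ → Scoped (TOut.nxt t₁) C₂ t₂ → Boundary t₁ → Boundary t₂ → Boundary (tens2 K R t₁ t₂)
boundary-tens2 K R (tout _ vs₁ ls₁ hv₁ r₁) (tout m vs₂ ls₂ hv₂ r₂) S₁ S₂ B₁ B₂ = record
  { hyps-unique = subst Unique (sym (hypVertices-++ hv₁ hv₂))
      (UniqueP.++⁺ B₁.hyps-unique B₂.hyps-unique (λ (v∈₁ , v∈₂) → apart (S₁.hyp∈ v∈₁ , S₂.hyp∈ v∈₂)))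
  ; hyp⇒¬concl = hyp⇒¬concl
  ; ¬concl⇒hyp = ¬concl⇒hyp
  ; root-¬prem = root-¬prem
  ; ¬prem⇒root = ¬prem⇒root
  }
  where
    module S₁ = Scoped S₁
    module S₂ = Scoped S₂
    module B₁ = Boundary B₁
    module B₂ = Boundary B₂
    apart = scoped-apart S₁ S₂
    L = link K (r₁ ∷ r₂ ∷ []) (m ∷ [])

    below : ∀ {v} → v ∈ vertexIds vs₁ ⊎ v ∈ vertexIds vs₂ → v < m
    below (inj₁ v∈₁) = <-≤-trans (S₁.<nxt v∈₁) S₂.start≤nxt
    below (inj₂ v∈₂) = S₂.<nxt v∈₂

    hyp⇒¬concl : ∀ {v} → v ∈ hypVertices (AllP.++⁺ hv₁ hv₂) → ¬ ConclOf (L ∷ ls₁ ++ ls₂) v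
    hyp⇒¬concl v∈ c with ∈-hypVertices-++⁻ hv₁ hv₂ v∈ | Any-∷-++⁻ ls₁ c
    ... | inj₁ v∈₁ | inj₁ (here refl) = <-irrefl refl (below (inj₁ (S₁.hyp∈ v∈₁)))
    ... | inj₁ v∈₁ | inj₂ (inj₁ c₁)   = B₁.hyp⇒¬concl v∈₁ c₁
    ... | inj₁ v∈₁ | inj₂ (inj₂ c₂)   = apart (S₁.hyp∈ v∈₁ , S₂.concl∈ c₂)
    ... | inj₂ v∈₂ | inj₁ (here refl) = <-irrefl refl (below (inj₂ (S₂.hyp∈ v∈₂)))
    ... | inj₂ v∈₂ | inj₂ (inj₁ c₁)   = apart (S₁.concl∈ c₁ , S₂.hyp∈ v∈₂)
    ... | inj₂ v∈₂ | inj₂ (inj₂ c₂)   = B₂.hyp⇒¬concl v∈₂ c₂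

    ¬concl⇒hyp : ∀ {v} → v ∈ m ∷ vertexIds (vs₁ ++ vs₂) → ¬ ConclOf (L ∷ ls₁ ++ ls₂) v →
                 v ∈ hypVertices (AllP.++⁺ hv₁ hv₂)
    ¬concl⇒hyp (here refl) ¬c = ⊥-elim (¬c (here (here refl)))
    ¬concl⇒hyp (there v∈) ¬c with ∈-vertexIds-++⁻ vs₁ vs₂ v∈
    ... | inj₁ v∈₁ = ∈-hypVertices-++⁺ˡ hv₁ hv₂ (B₁.¬concl⇒hyp v∈₁ (¬c ∘ there ∘ AnyP.++⁺ˡ))
    ... | inj₂ v∈₂ = ∈-hypVertices-++⁺ʳ hv₁ hv₂ (B₂.¬concl⇒hyp v∈₂ (¬c ∘ there ∘ AnyP.++⁺ʳ ls₁))

    root-¬prem : ¬ PremOf (L ∷ ls₁ ++ ls₂) m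
    root-¬prem p with Any-∷-++⁻ ls₁ p
    ... | inj₁ m∈ with ∈-pair⁻ m∈
    ...   | inj₁ m≡r₁ = <-irrefl (sym m≡r₁) (below (inj₁ S₁.root∈ids))
    ...   | inj₂ m≡r₂ = <-irrefl (sym m≡r₂) (below (inj₂ S₂.root∈ids))
    root-¬prem p | inj₂ (inj₁ p₁) = <-irrefl refl (below (inj₁ (S₁.prem∈ p₁)))
    root-¬prem p | inj₂ (inj₂ p₂) = <-irrefl refl (below (inj₂ (S₂.prem∈ p₂)))

    ¬prem⇒root : ∀ {v} → v ∈ m ∷ vertexIds (vs₁ ++ vs₂) → ¬ PremOf (L ∷ ls₁ ++ ls₂) v → v ≡ m
    ¬prem⇒root (here v≡m) _ = v≡m
    ¬prem⇒root (there v∈) ¬p with ∈-vertexIds-++⁻ vs₁ vs₂ v∈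
    ... | inj₁ v∈₁ = ⊥-elim (¬p (here (here (B₁.¬prem⇒root v∈₁ (¬p ∘ there ∘ AnyP.++⁺ˡ)))))
    ... | inj₂ v∈₂ = ⊥-elim (¬p (here (there (here (B₂.¬prem⇒root v∈₂ (¬p ∘ there ∘ AnyP.++⁺ʳ ls₁))))))

scoped-intro : ∀ {x Γ n C R K m vs ls h hs r cs} → (∀ {v} → v ∈ cs → v ≡ h ⊎ v ≡ m) →
  Scoped {x ∷ Γ} n C (tout m vs ls (h ∷ hs) r) →
  Scoped {Γ} n R (tout (suc m) ((m , R) ∷ vs) (link K (r ∷ []) cs ∷ ls) hs m)
scoped-intro {Γ = Γ} {n} {R = R} {K} {m} {vs} {ls} {h} {hs} {r} {cs} cs⊆ S = record
  { start≤nxt  = ≤-trans S.start≤nxt (n≤1+n m)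
  ; ids-range  = ids-range
  ; ids-unique = All.tabulate (λ v∈ m≡v → <-irrefl (sym m≡v) (S.<nxt v∈)) ∷ S.ids-unique
  ; root∈      = here refl
  ; prem∈      = λ { (here (here refl)) → there S.root∈ids ; (there p) → there (S.prem∈ p) }
  ; concl∈     = concl∈
  ; labelled   = Labelled-mono there Γ hs (proj₂ S.labelled)
  }
  where
    module S = Scoped S

    ids-range : ∀ {v} → v ∈ m ∷ vertexIds vs → n ≤ v × v < suc m
    ids-range (here refl) = S.start≤nxt , n<1+n m
    ids-range (there v∈)  = proj₁ (S.ids-range v∈) , <-trans (S.<nxt v∈) (n<1+n m)

    concl∈ : ∀ {v} → ConclOf (link K (r ∷ []) cs ∷ ls) v → v ∈ m ∷ vertexIds vs
    concl∈ (here v∈cs) with cs⊆ v∈cs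
    ... | inj₁ refl = there (S.hyp∈ (here refl))
    ... | inj₂ refl = here refl
    concl∈ (there c) = there (S.concl∈ c)

boundary-intro : ∀ {x Γ n C R K m vs ls h hs r cs} → (∀ {v} → v ∈ cs → v ≡ h ⊎ v ≡ m) → h ∈ cs → m ∈ cs →
  Scoped {x ∷ Γ} n C (tout m vs ls (h ∷ hs) r) → Boundary {x ∷ Γ} (tout m vs ls (h ∷ hs) r) →
  Boundary {Γ} (tout (suc m) ((m , R) ∷ vs) (link K (r ∷ []) cs ∷ ls) hs m)
boundary-intro {K = K} {m} {vs} {ls} {h} {hs} {r} {cs} cs⊆ h∈cs m∈cs S B = record
  { hyps-unique = Unique-++⁻ʳ [ h ] B.hyps-unique
  ; hyp⇒¬concl  = hyp⇒¬concl
  ; ¬concl⇒hyp  = ¬concl⇒hyp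
  ; root-¬prem  = λ { (here (here m≡r)) → <-irrefl (sym m≡r) (S.<nxt S.root∈ids)
                    ; (there p)          → <-irrefl refl (S.<nxt (S.prem∈ p)) }
  ; ¬prem⇒root  = λ { (here v≡m) _  → v≡m
                    ; (there v∈) ¬p → ⊥-elim (¬p (here (here (B.¬prem⇒root v∈ (¬p ∘ there))))) }
  }
  where
    module S = Scoped S
    module B = Boundary B
    L = link K (r ∷ []) cs

    hyp⇒¬concl : ∀ {v} → v ∈ hypVertices hs → ¬ ConclOf (L ∷ ls) v
    hyp⇒¬concl v∈ (here v∈cs) with cs⊆ v∈cs
    ... | inj₁ refl = UniqueP.Unique[x∷xs]⇒x∉xs B.hyps-unique v∈
    ... | inj₂ refl = <-irrefl refl (S.<nxt (S.hyp∈ (there v∈)))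
    hyp⇒¬concl v∈ (there c) = B.hyp⇒¬concl (there v∈) c

    ¬concl⇒hyp : ∀ {v} → v ∈ m ∷ vertexIds vs → ¬ ConclOf (L ∷ ls) v → v ∈ hypVertices hs
    ¬concl⇒hyp (here refl) ¬c = ⊥-elim (¬c (here m∈cs))
    ¬concl⇒hyp (there v∈)  ¬c with B.¬concl⇒hyp v∈ (¬c ∘ there)
    ... | here refl  = ⊥-elim (¬c (here h∈cs))
    ... | there v∈hs = v∈hs

scoped-parI : ∀ {x Γ n C} K af R (t : TOut (x ∷ Γ)) → Scoped n C t → Scoped n R (parI K af R t)
scoped-parI K true  R (tout _ _ _ (_ ∷ _) _) = scoped-intro ∈-pair⁻
scoped-parI K false R (tout _ _ _ (_ ∷ _) _) = scoped-intro (λ v∈ → swap (∈-pair⁻ v∈))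

boundary-parI : ∀ {x Γ n C} K af R (t : TOut (x ∷ Γ)) → Scoped n C t → Boundary t → Boundary (parI K af R t)
boundary-parI K true  R (tout _ _ _ (_ ∷ _) _) = boundary-intro ∈-pair⁻ (here refl) (there (here refl))
boundary-parI K false R (tout _ _ _ (_ ∷ _) _) =
  boundary-intro (λ v∈ → swap (∈-pair⁻ v∈)) (there (here refl)) (here refl)

scoped-parE : ∀ {Γ x y Δ n C₁ C₂} K (t₁ : TOut Γ) (t₂ : TOut (x ∷ y ∷ Δ)) →
  Scoped n C₁ t₁ → Scoped (TOut.nxt t₁) C₂ t₂ → Scoped n C₂ (parE K t₁ t₂)
scoped-parE {Γ} {Δ = Δ} K (tout _ vs₁ ls₁ hv₁ r₁) (tout m vs₂ ls₂ (ha ∷ hb ∷ hs) r₂) S₁ S₂ = record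
  { start≤nxt  = ≤-trans S₁.start≤nxt S₂.start≤nxt
  ; ids-range  = scoped-joined-range S₁ S₂
  ; ids-unique = scoped-joined-unique S₁ S₂
  ; root∈      = ∈-++⁺ʳ vs₁ S₂.root∈
  ; prem∈      = prem∈
  ; concl∈     = concl∈
  ; labelled   = Labelled-++ Γ Δ hv₁ hs (Labelled-mono ∈-++⁺ˡ Γ hv₁ S₁.labelled)
                                        (Labelled-mono (∈-++⁺ʳ vs₁) Δ hs (proj₂ (proj₂ S₂.labelled)))
  }
  where
    module S₁ = Scoped S₁
    module S₂ = Scoped S₂
    L = link K (r₁ ∷ []) (ha ∷ hb ∷ [])

    prem∈ : ∀ {v} → PremOf (L ∷ ls₁ ++ ls₂) v → v ∈ vertexIds (vs₁ ++ vs₂)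
    prem∈ p with Any-∷-++⁻ ls₁ p
    ... | inj₁ (here refl) = ∈-vertexIds-++⁺ˡ vs₁ vs₂ S₁.root∈ids
    ... | inj₂ (inj₁ p₁)   = ∈-vertexIds-++⁺ˡ vs₁ vs₂ (S₁.prem∈ p₁)
    ... | inj₂ (inj₂ p₂)   = ∈-vertexIds-++⁺ʳ vs₁ vs₂ (S₂.prem∈ p₂)

    concl∈ : ∀ {v} → ConclOf (L ∷ ls₁ ++ ls₂) v → v ∈ vertexIds (vs₁ ++ vs₂)
    concl∈ c with Any-∷-++⁻ ls₁ c
    ... | inj₁ v∈ab      = ∈-vertexIds-++⁺ʳ vs₁ vs₂ (S₂.hyp∈ (∈-++⁺ˡ v∈ab))
    ... | inj₂ (inj₁ c₁) = ∈-vertexIds-++⁺ˡ vs₁ vs₂ (S₁.concl∈ c₁)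
    ... | inj₂ (inj₂ c₂) = ∈-vertexIds-++⁺ʳ vs₁ vs₂ (S₂.concl∈ c₂)

boundary-parE : ∀ {Γ x y Δ n C₁ C₂} K (t₁ : TOut Γ) (t₂ : TOut (x ∷ y ∷ Δ)) →
  Scoped n C₁ t₁ → Scoped (TOut.nxt t₁) C₂ t₂ → Boundary t₁ → Boundary t₂ → Boundary (parE K t₁ t₂)
boundary-parE K (tout _ vs₁ ls₁ hv₁ r₁) (tout m vs₂ ls₂ (ha ∷ hb ∷ hs) r₂) S₁ S₂ B₁ B₂ = record
  { hyps-unique = subst Unique (sym (hypVertices-++ hv₁ hs))
      (UniqueP.++⁺ B₁.hyps-unique (Unique-++⁻ʳ (ha ∷ hb ∷ []) B₂.hyps-unique)
        (λ (v∈₁ , v∈₂) → apart (S₁.hyp∈ v∈₁ , S₂.hyp∈ (there (there v∈₂)))))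
  ; hyp⇒¬concl  = hyp⇒¬concl
  ; ¬concl⇒hyp  = ¬concl⇒hyp
  ; root-¬prem  = root-¬prem
  ; ¬prem⇒root  = ¬prem⇒root
  }
  where
    module S₁ = Scoped S₁
    module S₂ = Scoped S₂
    module B₁ = Boundary B₁
    module B₂ = Boundary B₂
    apart = scoped-apart S₁ S₂
    L = link K (r₁ ∷ []) (ha ∷ hb ∷ [])

    hyp⇒¬concl : ∀ {v} → v ∈ hypVertices (AllP.++⁺ hv₁ hs) → ¬ ConclOf (L ∷ ls₁ ++ ls₂) v
    hyp⇒¬concl v∈ c with ∈-hypVertices-++⁻ hv₁ hs v∈ | Any-∷-++⁻ ls₁ c
    ... | inj₁ v∈₁ | inj₁ v∈ab      = apart (S₁.hyp∈ v∈₁ , S₂.hyp∈ (∈-++⁺ˡ v∈ab))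
    ... | inj₁ v∈₁ | inj₂ (inj₁ c₁) = B₁.hyp⇒¬concl v∈₁ c₁
    ... | inj₁ v∈₁ | inj₂ (inj₂ c₂) = apart (S₁.hyp∈ v∈₁ , S₂.concl∈ c₂)
    ... | inj₂ v∈₂ | inj₁ v∈ab      = Unique-++⇒Disjoint (ha ∷ hb ∷ []) B₂.hyps-unique (v∈ab , v∈₂)
    ... | inj₂ v∈₂ | inj₂ (inj₁ c₁) = apart (S₁.concl∈ c₁ , S₂.hyp∈ (there (there v∈₂)))
    ... | inj₂ v∈₂ | inj₂ (inj₂ c₂) = B₂.hyp⇒¬concl (there (there v∈₂)) c₂

    ¬concl⇒hyp : ∀ {v} → v ∈ vertexIds (vs₁ ++ vs₂) → ¬ ConclOf (L ∷ ls₁ ++ ls₂) v →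
                 v ∈ hypVertices (AllP.++⁺ hv₁ hs)
    ¬concl⇒hyp v∈ ¬c with ∈-vertexIds-++⁻ vs₁ vs₂ v∈
    ... | inj₁ v∈₁ = ∈-hypVertices-++⁺ˡ hv₁ hs (B₁.¬concl⇒hyp v∈₁ (¬c ∘ there ∘ AnyP.++⁺ˡ))
    ... | inj₂ v∈₂ with B₂.¬concl⇒hyp v∈₂ (¬c ∘ there ∘ AnyP.++⁺ʳ ls₁)
    ...   | here refl         = ⊥-elim (¬c (here (here refl)))
    ...   | there (here refl) = ⊥-elim (¬c (here (there (here refl))))
    ...   | there (there v∈hs) = ∈-hypVertices-++⁺ʳ hv₁ hs v∈hs

    root-¬prem : ¬ PremOf (L ∷ ls₁ ++ ls₂) r₂
    root-¬prem p with Any-∷-++⁻ ls₁ p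
    ... | inj₁ (here refl) = apart (S₁.root∈ids , S₂.root∈ids)
    ... | inj₂ (inj₁ p₁)   = apart (S₁.prem∈ p₁ , S₂.root∈ids)
    ... | inj₂ (inj₂ p₂)   = B₂.root-¬prem p₂

    ¬prem⇒root : ∀ {v} → v ∈ vertexIds (vs₁ ++ vs₂) → ¬ PremOf (L ∷ ls₁ ++ ls₂) v → v ≡ r₂
    ¬prem⇒root v∈ ¬p with ∈-vertexIds-++⁻ vs₁ vs₂ v∈
    ... | inj₁ v∈₁ = ⊥-elim (¬p (here (here (B₁.¬prem⇒root v∈₁ (¬p ∘ there ∘ AnyP.++⁺ˡ)))))
    ... | inj₂ v∈₂ = B₂.¬prem⇒root v∈₂ (¬p ∘ there ∘ AnyP.++⁺ʳ ls₁)

translate-scoped : ∀ {Γ γ C} n (d : Γ ⊢ γ ∶ C) → Scoped n C (translate n d)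
translate-scoped n (hyp _ hl) = record
  { start≤nxt  = n≤1+n n
  ; ids-range  = λ { (here refl) → ≤-refl , n<1+n n }
  ; ids-unique = [] ∷ []
  ; root∈      = here refl
  ; prem∈      = λ ()
  ; concl∈     = λ ()
  ; labelled   = (here refl , hl) , tt
  }
translate-scoped n (perm p d) with translate n d | translate-scoped n d
... | tout _ _ _ hv _ | S = record { S′ hiding (labelled) ; labelled = Labelled-resp-↭ p hv S′.labelled }
  where module S′ = Scoped S
translate-scoped n (⧹E d e)   = scoped-tens2 _ _ _ _ (translate-scoped n d) (translate-scoped _ e)
translate-scoped n (⧸E d e)   = scoped-tens2 _ _ _ _ (translate-scoped n d) (translate-scoped _ e)
translate-scoped n (•I d e)   = scoped-tens2 _ _ _ _ (translate-scoped n d) (translate-scoped _ e)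
translate-scoped n (↓E _ d e) = scoped-tens2 _ _ _ _ (translate-scoped n d) (translate-scoped _ e)
translate-scoped n (↑E _ d e) = scoped-tens2 _ _ _ _ (translate-scoped n d) (translate-scoped _ e)
translate-scoped n (⊙I _ d e) = scoped-tens2 _ _ _ _ (translate-scoped n d) (translate-scoped _ e)
translate-scoped n (⧹I d)     = scoped-parI _ _ _ _ (translate-scoped n d)
translate-scoped n (⧸I d)     = scoped-parI _ _ _ _ (translate-scoped n d)
translate-scoped n (↓I _ d)   = scoped-parI _ _ _ _ (translate-scoped n d)
translate-scoped n (↑I _ d)   = scoped-parI _ _ _ _ (translate-scoped n d)
translate-scoped n (•E d e)   = scoped-parE _ _ _ (translate-scoped n d) (translate-scoped _ e)
translate-scoped n (⊙E _ d e) = scoped-parE _ _ _ (translate-scoped n d) (translate-scoped _ e)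

translate-boundary : ∀ {Γ γ C} n (d : Γ ⊢ γ ∶ C) → Boundary (translate n d)
translate-boundary n (hyp _ _) = record
  { hyps-unique = [] ∷ []
  ; hyp⇒¬concl  = λ _ ()
  ; ¬concl⇒hyp  = λ v∈ _ → v∈
  ; root-¬prem  = λ ()
  ; ¬prem⇒root  = λ { (here refl) _ → refl }
  }
translate-boundary n (perm p d) with translate n d | translate-boundary n d
... | tout _ _ _ hv _ | B = record
  { hyps-unique = Unique-resp-↭ (↭-sym hv↭) B.hyps-unique
  ; hyp⇒¬concl  = B.hyp⇒¬concl ∘ ∈-resp-↭ hv↭
  ; ¬concl⇒hyp  = λ v∈ ¬c → ∈-resp-↭ (↭-sym hv↭) (B.¬concl⇒hyp v∈ ¬c)
  ; root-¬prem  = B.root-¬prem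
  ; ¬prem⇒root  = B.¬prem⇒root
  }
  where
    module B = Boundary B
    hv↭ = hypVertices-resp-↭ p hv
translate-boundary n (⧹E d e)   = boundary-tens2 _ _ _ _ (translate-scoped n d) (translate-scoped _ e)
                                    (translate-boundary n d) (translate-boundary _ e)
translate-boundary n (⧸E d e)   = boundary-tens2 _ _ _ _ (translate-scoped n d) (translate-scoped _ e)
                                    (translate-boundary n d) (translate-boundary _ e)
translate-boundary n (•I d e)   = boundary-tens2 _ _ _ _ (translate-scoped n d) (translate-scoped _ e)
                                    (translate-boundary n d) (translate-boundary _ e)
translate-boundary n (↓E _ d e) = boundary-tens2 _ _ _ _ (translate-scoped n d) (translate-scoped _ e)
                                    (translate-boundary n d) (translate-boundary _ e)
translate-boundary n (↑E _ d e) = boundary-tens2 _ _ _ _ (translate-scoped n d) (translate-scoped _ e)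
                                    (translate-boundary n d) (translate-boundary _ e)
translate-boundary n (⊙I _ d e) = boundary-tens2 _ _ _ _ (translate-scoped n d) (translate-scoped _ e)
                                    (translate-boundary n d) (translate-boundary _ e)
translate-boundary n (⧹I d)     = boundary-parI _ _ _ _ (translate-scoped n d) (translate-boundary n d)
translate-boundary n (⧸I d)     = boundary-parI _ _ _ _ (translate-scoped n d) (translate-boundary n d)
translate-boundary n (↓I _ d)   = boundary-parI _ _ _ _ (translate-scoped n d) (translate-boundary n d)
translate-boundary n (↑I _ d)   = boundary-parI _ _ _ _ (translate-scoped n d) (translate-boundary n d)
translate-boundary n (•E d e)   = boundary-parE _ _ _ (translate-scoped n d) (translate-scoped _ e)
                                    (translate-boundary n d) (translate-boundary _ e)
translate-boundary n (⊙E _ d e) = boundary-parE _ _ _ (translate-scoped n d) (translate-scoped _ e)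
                                    (translate-boundary n d) (translate-boundary _ e)

-- Contraction of the abstract structure of a translation

data IsPlus : LinkKind → Set where
  Lover  : IsPlus Lover
  Lunder : IsPlus Lunder
  Rprod  : IsPlus Rprod

data IsWrap (k : Mode) : LinkKind → Set where
  Lextr  : IsWrap k (Lextr k)
  Linfix : IsWrap k (Linfix k)
  Rwprod : IsWrap k (Rwprod k)

module Contraction (P : PS) where

  open UpToPermutation (asort P)

  combsOf : List Link → List ALink
  combsOf = concatMap (convLink P)

  combsOf-++ : ∀ ls₁ ls₂ → combsOf (ls₁ ++ ls₂) ≡ combsOf ls₁ ++ combsOf ls₂
  combsOf-++ []        ls₂ = refl
  combsOf-++ (l ∷ ls₁) ls₂ =
    trans (cong (convLink P l ++_) (combsOf-++ ls₁ ls₂)) (sym (++-assoc (convLink P l) _ _))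

  hypCombs : Sub → (Γ : Ctx) → All (λ _ → ℕ) Γ → List ALink
  hypCombs σ []            []       = []
  hypCombs σ ((α , _) ∷ Γ) (h ∷ hv) = comb (apply σ α) (orig h) ∷ hypCombs σ Γ hv

  hypCombs-++ : ∀ σ Γ Δ hv₁ hv₂ →
                hypCombs σ (Γ ++ Δ) (AllP.++⁺ hv₁ hv₂) ≡ hypCombs σ Γ hv₁ ++ hypCombs σ Δ hv₂
  hypCombs-++ σ []      Δ []        hv₂ = refl
  hypCombs-++ σ (_ ∷ Γ) Δ (_ ∷ hv₁) hv₂ = cong (_ ∷_) (hypCombs-++ σ Γ Δ hv₁ hv₂)

  hypCombs-resp-↭ : ∀ σ {Γ Δ} (p : Γ ↭ Δ) hv → hypCombs σ Δ (All-resp-↭ p hv) ↭ hypCombs σ Γ hv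
  hypCombs-resp-↭ σ ↭.refl         hv           = ↭-refl
  hypCombs-resp-↭ σ (↭.prep _ p)   (_ ∷ hv)     = ↭-prep _ (hypCombs-resp-↭ σ p hv)
  hypCombs-resp-↭ σ (↭.swap _ _ p) (_ ∷ _ ∷ hv) = ↭-swap _ _ (hypCombs-resp-↭ σ p hv)
  hypCombs-resp-↭ σ (↭.trans p q)  hv           = ↭-trans (hypCombs-resp-↭ σ q _) (hypCombs-resp-↭ σ p hv)

  hypCombs-assign-outside : ∀ {X n} σ f (hl : HypLabel X n) Γ hv → Disjoint (ctxVars Γ) (vars X) →
                            hypCombs (assign σ f hl) Γ hv ≡ hypCombs σ Γ hv
  hypCombs-assign-outside σ f hl []            []       _    = refl
  hypCombs-assign-outside σ f hl ((α , _) ∷ Γ) (h ∷ hv) disj =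
    cong₂ _∷_ (cong (λ qs → comb qs (orig h))
                (apply-assign-outside σ f hl α (λ (y∈α , y∈X) → disj (∈-++⁺ˡ y∈α , y∈X))))
              (hypCombs-assign-outside σ f hl Γ hv (λ (y∈Γ , y∈X) → disj (∈-++⁺ʳ (vars α) y∈Γ , y∈X)))

  structure : ∀ {Γ} → Sub → TOut Γ → List ALink
  structure {Γ} σ t = combsOf (TOut.ls t) ++ hypCombs σ Γ (TOut.hv t)

  Yields : ∀ {Γ} → Sub → TOut Γ → List Prem → Set
  Yields σ t qs = structure σ t ↠ [ comb qs (orig (TOut.root t)) ]

  -- The split auxiliary input w₀ … wₙ of h; convLink builds the same list.
  splitInput : ℕ → List AV
  splitInput h = map (wv h) (upTo (suc (asort P (orig h))))

  auxComb : ℕ → ALink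
  auxComb h = comb (Wp (splitInput h)) (orig h)

  assign-input : ∀ {X A σ h} (hl : HypLabel X (sort A)) → lookupF (PS.verts P) h ≡ just A → Unique (vars X) →
                 apply (assign σ (wv h) hl) X ≡ Wp (splitInput h)
  assign-input {A = A} {σ} {h} hl eq u rewrite eq =
    trans (apply-assign-label σ (wv h) hl u) (cong Wp (sym (map-applyUpTo (wv h) (λ i → i) (suc (sort A)))))

  discharge : ∀ {X A Γ σ h hs} (hl : HypLabel X (sort A)) → lookupF (PS.verts P) h ≡ just A →
    Unique (ctxVars ((X , A) ∷ Γ)) →
    hypCombs (assign σ (wv h) hl) ((X , A) ∷ Γ) (h ∷ hs) ≡ auxComb h ∷ hypCombs σ Γ hs
  discharge {X} {Γ = Γ} {σ} {h} {hs} hl eq u =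
    cong₂ _∷_ (cong (λ qs → comb qs (orig h)) (assign-input hl eq (Unique-++⁻ˡ (vars X) u)))
              (hypCombs-assign-outside σ (wv h) hl Γ hs
                (λ (x∈Γ , x∈X) → Unique-++⇒Disjoint (vars X) u (x∈X , x∈Γ)))

  discharged : ∀ {X A Γ h hs r qs} σ ls (hl : HypLabel X (sort A)) → lookupF (PS.verts P) h ≡ just A →
    Unique (ctxVars ((X , A) ∷ Γ)) →
    combsOf ls ++ hypCombs (assign σ (wv h) hl) ((X , A) ∷ Γ) (h ∷ hs) ↠ [ comb qs (orig r) ] →
    combsOf ls ++ auxComb h ∷ hypCombs σ Γ hs ↠ [ comb qs (orig r) ]
  discharged {r = r} {qs} σ ls hl eq u y =
    subst (λ H → combsOf ls ++ H ↠ [ comb qs (orig r) ]) (discharge hl eq u) y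

  discharged₂ : ∀ {X Y A B Δ ha hb hs r qs} σ ls
    (hlA : HypLabel X (sort A)) (hlB : HypLabel Y (sort B)) →
    lookupF (PS.verts P) ha ≡ just A → lookupF (PS.verts P) hb ≡ just B →
    Unique (ctxVars ((X , A) ∷ (Y , B) ∷ Δ)) →
    combsOf ls ++ hypCombs (assign (assign σ (wv hb) hlB) (wv ha) hlA) ((X , A) ∷ (Y , B) ∷ Δ) (ha ∷ hb ∷ hs)
      ↠ [ comb qs (orig r) ] →
    combsOf ls ++ auxComb ha ∷ auxComb hb ∷ hypCombs σ Δ hs ↠ [ comb qs (orig r) ]
  discharged₂ {X} {Y} {B = B} {Δ} {ha = ha} {r = r} {qs = qs} σ ls hlA hlB eqA eqB u y =
    subst (λ H → combsOf ls ++ H ↠ [ comb qs (orig r) ])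
      (trans (discharge {Γ = (Y , B) ∷ Δ} hlA eqA u)
             (cong (auxComb ha ∷_) (discharge hlB eqB (Unique-++⁻ʳ (vars X) u))))
      y

  plus-link : ∀ {K r₁ r₂ m} → IsPlus K →
    convLink P (link K (r₁ ∷ r₂ ∷ []) (m ∷ [])) ≡ [ comb (vx (orig r₁) ∷ vx (orig r₂) ∷ []) (orig m) ]
  plus-link Lover  = refl
  plus-link Lunder = refl
  plus-link Rprod  = refl

  wrap-link : ∀ {k K r₁ r₂ m} → IsWrap k K →
    convLink P (link K (r₁ ∷ r₂ ∷ []) (m ∷ [])) ≡ [ tens k (orig r₁) (orig r₂) (orig m) ]
  wrap-link Lextr  = refl
  wrap-link Linfix = refl
  wrap-link Rwprod = refl

  tens2-structure : ∀ {Γ Δ} K R σ (t₁ : TOut Γ) (t₂ : TOut Δ) →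
    structure σ (tens2 K R t₁ t₂) ↭
    convLink P (link K (TOut.root t₁ ∷ TOut.root t₂ ∷ []) (TOut.nxt t₂ ∷ [])) ++ structure σ t₁ ++ structure σ t₂
  tens2-structure {Γ} {Δ} K R σ (tout _ _ ls₁ hv₁ r₁) (tout m _ ls₂ hv₂ r₂) = begin
    (L ++ combsOf (ls₁ ++ ls₂)) ++ hypCombs σ (Γ ++ Δ) (AllP.++⁺ hv₁ hv₂)
      ≡⟨ ++-assoc L _ _ ⟩
    L ++ combsOf (ls₁ ++ ls₂) ++ hypCombs σ (Γ ++ Δ) (AllP.++⁺ hv₁ hv₂)
      ≡⟨ cong (L ++_) (cong₂ _++_ (combsOf-++ ls₁ ls₂) (hypCombs-++ σ Γ Δ hv₁ hv₂)) ⟩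
    L ++ (combsOf ls₁ ++ combsOf ls₂) ++ (hypCombs σ Γ hv₁ ++ hypCombs σ Δ hv₂)
      ↭⟨ ++⁺ˡ L (++-interchange-↭ (combsOf ls₁) _ _ _) ⟩
    L ++ (combsOf ls₁ ++ hypCombs σ Γ hv₁) ++ (combsOf ls₂ ++ hypCombs σ Δ hv₂)
      ∎
    where
      open PermutationReasoning
      L = convLink P (link K (r₁ ∷ r₂ ∷ []) (m ∷ []))

  plus-yields : ∀ {Γ Δ K σ a b} R (t₁ : TOut Γ) (t₂ : TOut Δ) → IsPlus K →
    Yields σ t₁ a → Yields σ t₂ b → Yields σ (tens2 K R t₁ t₂) (a ++ b)
  plus-yields {K = K} {σ} R t₁ t₂ plus y₁ y₂ =
    ↠-trans (↭⇒↠ (tens2-structure K R σ t₁ t₂))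
      (↠-trans (↠-++ˡ _ (↠-++ y₁ y₂)) (subst (λ L → L ++ _ ↠ _) (sym (plus-link plus)) concat-↠))

  wrap-yields : ∀ {Γ Δ k K σ α₁ α₂ β} R (t₁ : TOut Γ) (t₂ : TOut Δ) → IsWrap k K →
    PSepPos (asort P) k α₁ α₂ → Yields σ t₁ (α₁ ++ 𝟏ᵖ ∷ α₂) → Yields σ t₂ β →
    Yields σ (tens2 K R t₁ t₂) (α₁ ++ β ++ α₂)
  wrap-yields {K = K} {σ} R t₁ t₂ wrap sep y₁ y₂ =
    ↠-trans (↭⇒↠ (tens2-structure K R σ t₁ t₂))
      (↠-trans (↠-++ˡ _ (↠-++ y₁ y₂)) (subst (λ L → L ++ _ ↠ _) (sym (wrap-link wrap)) (Redex⇒↠ (r× sep))))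

  intro-yields : ∀ {r qs pl R′} σ Γ ls h hs →
    combsOf ls ++ auxComb h ∷ hypCombs σ Γ hs ↠ [ comb qs (orig r) ] →
    Redex (asort P) (pl ∷ [ comb qs (orig r) ]) R′ →
    pl ∷ auxComb h ∷ combsOf ls ++ hypCombs σ Γ hs ↠ R′
  intro-yields σ Γ ls h hs y red =
    ↠-trans (↭⇒↠ (↭-prep _ (↭-sym (shift (auxComb h) (combsOf ls) (hypCombs σ Γ hs)))))
      (↠-trans (↠-++ˡ [ _ ] y) (Redex⇒↠ red))

  elim-yields : ∀ {Γ r δ body γ₁ γ₂ pb} σ Δ (t₁ : TOut Γ) ls ha hb hs →
    Yields σ t₁ δ →
    combsOf ls ++ auxComb ha ∷ auxComb hb ∷ hypCombs σ Δ hs ↠ [ comb body (orig r) ] →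
    Redex (asort P) (pb ∷ [ comb body (orig r) ]) [ comb (γ₁ ++ vx (orig (TOut.root t₁)) ∷ γ₂) (orig r) ] →
    pb ∷ auxComb ha ∷ auxComb hb ∷ combsOf (TOut.ls t₁ ++ ls) ++ hypCombs σ (Γ ++ Δ) (AllP.++⁺ (TOut.hv t₁) hs)
      ↠ [ comb (γ₁ ++ δ ++ γ₂) (orig r) ]
  elim-yields {Γ} {pb = pb} σ Δ t₁ ls ha hb hs y₁ y₂ red =
    ↠-trans (↭⇒↠ (↭-prep pb rearrange))
      (↠-trans (↠-++ (↠-++ˡ [ pb ] y₂) y₁)
        (↠-trans (↠-++ʳ _ (Redex⇒↠ red)) (Redex⇒↠ r+)))
    where
      open PermutationReasoning
      c₁ = combsOf (TOut.ls t₁)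
      h₁ = hypCombs σ Γ (TOut.hv t₁)
      c  = combsOf ls
      hΔ = hypCombs σ Δ hs
      aux = auxComb ha ∷ auxComb hb ∷ []
      rearrange : aux ++ combsOf (TOut.ls t₁ ++ ls) ++ hypCombs σ (Γ ++ Δ) (AllP.++⁺ (TOut.hv t₁) hs)
                  ↭ (c ++ aux ++ hΔ) ++ (c₁ ++ h₁)
      rearrange = begin
        aux ++ combsOf (TOut.ls t₁ ++ ls) ++ hypCombs σ (Γ ++ Δ) (AllP.++⁺ (TOut.hv t₁) hs)
          ≡⟨ cong (aux ++_) (cong₂ _++_ (combsOf-++ (TOut.ls t₁) ls) (hypCombs-++ σ Γ Δ (TOut.hv t₁) hs)) ⟩
        aux ++ (c₁ ++ c) ++ (h₁ ++ hΔ)  ↭⟨ ++⁺ˡ aux (++-interchange-↭ c₁ c h₁ hΔ) ⟩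
        aux ++ (c₁ ++ h₁) ++ (c ++ hΔ)  ↭⟨ ++⁺ˡ aux (↭-++-comm (c₁ ++ h₁) (c ++ hΔ)) ⟩
        aux ++ (c ++ hΔ) ++ (c₁ ++ h₁)  ≡⟨ cong (aux ++_) (++-assoc c hΔ _) ⟩
        aux ++ c ++ hΔ ++ (c₁ ++ h₁)    ↭⟨ shifts aux c ⟩
        c ++ aux ++ hΔ ++ (c₁ ++ h₁)    ≡⟨ ++-assoc c (aux ++ hΔ) _ ⟨
        (c ++ aux ++ hΔ) ++ (c₁ ++ h₁)  ∎

  -- Sorts, and hence the splitting of auxiliary inputs, are read off the whole structure P.
  ConsistentOn : List (ℕ × Formula) → Set
  ConsistentOn vs = ∀ {v A} → (v , A) ∈ vs → lookupF (PS.verts P) v ≡ just A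

  translate-yields : ∀ {Γ γ C} n (d : Γ ⊢ γ ∶ C) σ → VarSub σ → Fresh d →
                     ConsistentOn (TOut.vs (translate n d)) → Yields σ (translate n d) (apply σ γ)

  sub-yields : ∀ {Γ Δ γ δ A B} n (d : Γ ⊢ γ ∶ A) (e : Δ ⊢ δ ∶ B) σ → VarSub σ →
    Unique (hypVars d ++ hypVars e) →
    ConsistentOn (TOut.vs (translate n d) ++ TOut.vs (translate (TOut.nxt (translate n d)) e)) →
    Yields σ (translate n d) (apply σ γ) × Yields σ (translate (TOut.nxt (translate n d)) e) (apply σ δ)
  sub-yields n d e σ vσ fr cons =
    translate-yields n d σ vσ (Unique-++⁻ˡ (hypVars d) fr) (cons ∘ ∈-++⁺ˡ) ,
    translate-yields _ e σ vσ (Unique-++⁻ʳ (hypVars d) fr) (cons ∘ ∈-++⁺ʳ _)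

  translate-yields n (hyp _ _) σ vσ fr cons = ↭⇒↠ ↭-refl
  translate-yields n (perm p d) σ vσ fr cons with translate n d | translate-yields n d
  ... | tout _ _ ls hv _ | ih = ↠-trans (↭⇒↠ (++⁺ˡ (combsOf ls) (hypCombs-resp-↭ σ p hv))) (ih σ vσ fr cons)
  translate-yields n (⧹E {α = α} {γ} {C = C} d e) σ vσ fr cons =
    ↠-comb-≡ (sym (apply-++ σ α γ))
      (uncurry (plus-yields C (translate n d) (translate _ e) Lunder) (sub-yields n d e σ vσ fr (cons ∘ there)))
  translate-yields n (⧸E {γ = γ} {β} {C = C} d e) σ vσ fr cons =
    ↠-comb-≡ (sym (apply-++ σ γ β))
      (uncurry (plus-yields C (translate n d) (translate _ e) Lover) (sub-yields n d e σ vσ fr (cons ∘ there)))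
  translate-yields n (•I {α = α} {β} {A} {B} d e) σ vσ fr cons =
    ↠-comb-≡ (sym (apply-++ σ α β))
      (uncurry (plus-yields (A • B) (translate n d) (translate _ e) Rprod) (sub-yields n d e σ vσ fr (cons ∘ there)))
  translate-yields n (↓E {k = k} {a} {α} {γ} {C = C} sep d e) σ vσ fr cons =
    ↠-comb-≡ (sym (apply-++-++ σ a γ α))
      (wrap-yields C (translate n d) (translate _ e) Linfix (SepPos⇒PSepPos P vσ k sep)
        (↠-comb-≡ (apply-++ σ a (𝟏 ∷ α)) (proj₁ ys)) (proj₂ ys))
    where ys = sub-yields n d e σ vσ fr (cons ∘ there)
  translate-yields n (↑E {k = k} {c} {γ} {β} {C = C} sep d e) σ vσ fr cons =
    ↠-comb-≡ (sym (apply-++-++ σ c β γ))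
      (wrap-yields C (translate n d) (translate _ e) Lextr (SepPos⇒PSepPos P vσ k sep)
        (↠-comb-≡ (apply-++ σ c (𝟏 ∷ γ)) (proj₁ ys)) (proj₂ ys))
    where ys = sub-yields n d e σ vσ fr (cons ∘ there)
  translate-yields n (⊙I {k = k} {a} {α} {β} {A} {B} sep d e) σ vσ fr cons =
    ↠-comb-≡ (sym (apply-++-++ σ a β α))
      (wrap-yields (A ⊙[ k ] B) (translate n d) (translate _ e) Rwprod (SepPos⇒PSepPos P vσ k sep)
        (↠-comb-≡ (apply-++ σ a (𝟏 ∷ α)) (proj₁ ys)) (proj₂ ys))
    where ys = sub-yields n d e σ vσ fr (cons ∘ there)
  translate-yields n (⧹I {Γ} {α} {γ} d) σ vσ fr cons
    with translate n d | translate-yields n d | Scoped.labelled (translate-scoped n d)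
  ... | tout _ _ ls (h ∷ hs) r | ih | (h∈ , hl) , _ =
    intro-yields σ Γ ls h hs (↠-comb-≡ split (discharged σ ls hl look u y)) r⧹
    where
      look = cons (there h∈)
      u = Fresh⇒Unique-ctxVars d fr
      σ′ = assign σ (wv h) hl
      vσ′ = assign-VarSub (wv h) hl (inputVar h) vσ
      y = ih σ′ vσ′ fr (cons ∘ there)
      split : apply σ′ (α ++ γ) ≡ Wp (splitInput h) ++ apply σ γ
      split = trans (apply-++ σ′ α γ) (cong₂ _++_ (assign-input hl look (Unique-++⁻ˡ (vars α) u))
        (apply-assign-outside σ (wv h) hl γ (proj₂ (Unique-vars-frame [] α γ (Fresh⇒Unique-vars d fr)))))
  translate-yields n (⧸I {Γ} {γ} {β} d) σ vσ fr cons
    with translate n d | translate-yields n d | Scoped.labelled (translate-scoped n d)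
  ... | tout _ _ ls (h ∷ hs) r | ih | (h∈ , hl) , _ =
    intro-yields σ Γ ls h hs (↠-comb-≡ split (discharged σ ls hl look u y)) r⧸
    where
      look = cons (there h∈)
      u = Fresh⇒Unique-ctxVars d fr
      σ′ = assign σ (wv h) hl
      vσ′ = assign-VarSub (wv h) hl (inputVar h) vσ
      y = ih σ′ vσ′ fr (cons ∘ there)
      split : apply σ′ (γ ++ β) ≡ apply σ γ ++ Wp (splitInput h)
      split = trans (apply-++ σ′ γ β) (cong₂ _++_
        (apply-assign-outside σ (wv h) hl γ (Unique-vars-++⇒Disjoint γ β (Fresh⇒Unique-vars d fr)))
        (assign-input hl look (Unique-++⁻ˡ (vars β) u)))
  translate-yields n (↓I {Γ} {k} {a} {α} {γ} sep d) σ vσ fr cons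
    with translate n d | translate-yields n d | Scoped.labelled (translate-scoped n d)
  ... | tout _ _ ls (h ∷ hs) r | ih | (h∈ , hl) , _ =
    intro-yields σ Γ ls h hs (↠-comb-≡ split (discharged σ ls hl look u y))
      (r↓ (trans (sym input) (apply-++ σ′ a (𝟏 ∷ α)))
          (SepPos⇒PSepPos P vσ′ k sep))
    where
      look = cons (there h∈)
      u = Fresh⇒Unique-ctxVars d fr
      σ′ = assign σ (wv h) hl
      vσ′ = assign-VarSub (wv h) hl (inputVar h) vσ
      y = ih σ′ vσ′ fr (cons ∘ there)
      input : apply σ′ (a ++ 𝟏 ∷ α) ≡ Wp (splitInput h)
      input = assign-input hl look (Unique-++⁻ˡ (vars (a ++ 𝟏 ∷ α)) u)
      split : apply σ′ (a ++ γ ++ α) ≡ apply σ′ a ++ apply σ γ ++ apply σ′ α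
      split = trans (apply-++-++ σ′ a γ α) (cong (λ qs → apply σ′ a ++ qs ++ apply σ′ α)
        (apply-assign-outside σ (wv h) hl γ (λ (x∈γ , x∈X) →
          Unique-vars-middle a γ α (Fresh⇒Unique-vars d fr) (x∈γ , subst (_ ∈_) (vars-𝟏 a α) x∈X))))
  translate-yields n (↑I {Γ} {k} {c} {γ} {β} sep d) σ vσ fr cons
    with translate n d | translate-yields n d | Scoped.labelled (translate-scoped n d)
  ... | tout _ _ ls (h ∷ hs) r | ih | (h∈ , hl) , _ =
    ↠-comb-≡ (sym (apply-++ σ c (𝟏 ∷ γ)))
      (intro-yields σ Γ ls h hs (↠-comb-≡ split (discharged σ ls hl look u y))
        (r↑ (SepPos⇒PSepPos P vσ k sep)))
    where
      look = cons (there h∈)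
      u = Fresh⇒Unique-ctxVars d fr
      σ′ = assign σ (wv h) hl
      vσ′ = assign-VarSub (wv h) hl (inputVar h) vσ
      y = ih σ′ vσ′ fr (cons ∘ there)
      frame = Unique-vars-frame c β γ (Fresh⇒Unique-vars d fr)
      split : apply σ′ (c ++ β ++ γ) ≡ apply σ c ++ Wp (splitInput h) ++ apply σ γ
      split = trans (apply-++-++ σ′ c β γ) (cong₂ _++_ (apply-assign-outside σ (wv h) hl c (proj₁ frame))
        (cong₂ _++_ (assign-input hl look (Unique-++⁻ˡ (vars β) u))
                    (apply-assign-outside σ (wv h) hl γ (proj₂ frame))))
  translate-yields n (•E {Γ} {Δ} {δ} {α} {β} {γ₁} {γ₂} d e) σ vσ fr cons
    with translate (TOut.nxt (translate n d)) e | translate-yields (TOut.nxt (translate n d)) e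
       | Scoped.labelled (translate-scoped (TOut.nxt (translate n d)) e)
  ... | tout _ _ ls (ha ∷ hb ∷ hs) _ | ih | (ha∈ , hlA) , (hb∈ , hlB) , _ =
    ↠-comb-≡ (sym (apply-++-++ σ γ₁ δ γ₂))
      (elim-yields σ Δ (translate n d) ls ha hb hs y₁
        (↠-comb-≡ split (discharged₂ σ ls hlA hlB lookA lookB u (ih σ₂ vσ₂ fr₂ (cons ∘ ∈-++⁺ʳ _))))
        (r• {γ₁ = apply σ γ₁} {apply σ γ₂}))
    where
      fr₂ = Unique-++⁻ʳ (hypVars d) fr
      y₁ = translate-yields n d σ vσ (Unique-++⁻ˡ (hypVars d) fr) (cons ∘ ∈-++⁺ˡ)
      lookA = cons (∈-++⁺ʳ _ ha∈)
      lookB = cons (∈-++⁺ʳ _ hb∈)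
      u = Fresh⇒Unique-ctxVars e fr₂
      σ₁ = assign σ (wv hb) hlB
      σ₂ = assign σ₁ (wv ha) hlA
      vσ₂ = assign-VarSub (wv ha) hlA (inputVar ha) (assign-VarSub (wv hb) hlB (inputVar hb) vσ)
      frame = Unique-vars-frame γ₁ (α ++ β) γ₂
                (subst (λ s → Unique (vars (γ₁ ++ s))) (sym (++-assoc α β γ₂)) (Fresh⇒Unique-vars e fr₂))
      outside : ∀ s → Disjoint (vars s) (vars (α ++ β)) → apply σ₂ s ≡ apply σ s
      outside s disj = apply-assign₂-outside σ (wv ha) (wv hb) hlA hlB s
        (λ (x∈s , x∈αβ) → disj (x∈s , subst (_ ∈_) (sym (vars-++ α β)) x∈αβ))
      inputB : apply σ₂ β ≡ Wp (splitInput hb)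
      inputB = trans (apply-assign-outside σ₁ (wv ha) hlA β
                       (λ (x∈β , x∈α) → Unique-++⇒Disjoint (vars α) u (x∈α , ∈-++⁺ˡ x∈β)))
                     (assign-input hlB lookB (Unique-++⁻ˡ (vars β) (Unique-++⁻ʳ (vars α) u)))
      split : apply σ₂ (γ₁ ++ α ++ β ++ γ₂) ≡
              apply σ γ₁ ++ Wp (splitInput ha) ++ Wp (splitInput hb) ++ apply σ γ₂
      split = trans (apply-++-++ σ₂ γ₁ α (β ++ γ₂))
        (cong₂ _++_ (outside γ₁ (proj₁ frame))
          (cong₂ _++_ (assign-input hlA lookA (Unique-++⁻ˡ (vars α) u))
            (trans (apply-++ σ₂ β γ₂) (cong₂ _++_ inputB (outside γ₂ (proj₂ frame))))))
  translate-yields n (⊙E {Γ} {Δ} {k} {δ} {a} {α} {β} {γ₁} {γ₂} sep d e) σ vσ fr cons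
    with translate (TOut.nxt (translate n d)) e | translate-yields (TOut.nxt (translate n d)) e
       | Scoped.labelled (translate-scoped (TOut.nxt (translate n d)) e)
  ... | tout _ _ ls (ha ∷ hb ∷ hs) _ | ih | (ha∈ , hlA) , (hb∈ , hlB) , _ =
    ↠-comb-≡ (sym (apply-++-++ σ γ₁ δ γ₂))
      (elim-yields σ Δ (translate n d) ls ha hb hs y₁
        (↠-comb-≡ split (discharged₂ σ ls hlA hlB lookA lookB u (ih σ₂ vσ₂ fr₂ (cons ∘ ∈-++⁺ʳ _))))
        (r⊙ {γ₁ = apply σ γ₁} {apply σ γ₂} (trans (sym inputA) (apply-++ σ₂ a (𝟏 ∷ α)))
                                          (SepPos⇒PSepPos P vσ₂ k sep)))
    where
      X = a ++ 𝟏 ∷ α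
      fr₂ = Unique-++⁻ʳ (hypVars d) fr
      y₁ = translate-yields n d σ vσ (Unique-++⁻ˡ (hypVars d) fr) (cons ∘ ∈-++⁺ˡ)
      lookA = cons (∈-++⁺ʳ _ ha∈)
      lookB = cons (∈-++⁺ʳ _ hb∈)
      u = Fresh⇒Unique-ctxVars e fr₂
      σ₁ = assign σ (wv hb) hlB
      σ₂ = assign σ₁ (wv ha) hlA
      vσ₂ = assign-VarSub (wv ha) hlA (inputVar ha) (assign-VarSub (wv hb) hlB (inputVar hb) vσ)
      reassoc : (a ++ β ++ α) ++ γ₂ ≡ a ++ β ++ α ++ γ₂
      reassoc = trans (++-assoc a (β ++ α) γ₂) (cong (a ++_) (++-assoc β α γ₂))
      frame = Unique-vars-frame γ₁ (a ++ β ++ α) γ₂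
                (subst (λ s → Unique (vars (γ₁ ++ s))) (sym reassoc) (Fresh⇒Unique-vars e fr₂))
      outside : ∀ s → Disjoint (vars s) (vars (a ++ β ++ α)) → apply σ₂ s ≡ apply σ s
      outside s disj = apply-assign₂-outside σ (wv ha) (wv hb) hlA hlB s
        (λ (x∈s , x∈Xβ) → disj (x∈s , ∈-resp-↭ (↭-sym (vars-wrap a β α)) x∈Xβ))
      inputA : apply σ₂ X ≡ Wp (splitInput ha)
      inputA = assign-input hlA lookA (Unique-++⁻ˡ (vars X) u)
      inputB : apply σ₂ β ≡ Wp (splitInput hb)
      inputB = trans (apply-assign-outside σ₁ (wv ha) hlA β
                       (λ (x∈β , x∈X) → Unique-++⇒Disjoint (vars X) u (x∈X , ∈-++⁺ˡ x∈β)))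
                     (assign-input hlB lookB (Unique-++⁻ˡ (vars β) (Unique-++⁻ʳ (vars X) u)))
      split : apply σ₂ (γ₁ ++ a ++ β ++ α ++ γ₂) ≡
              apply σ γ₁ ++ apply σ₂ a ++ Wp (splitInput hb) ++ apply σ₂ α ++ apply σ γ₂
      split = trans (apply-++ σ₂ γ₁ _) (cong₂ _++_ (outside γ₁ (proj₁ frame))
        (trans (apply-++ σ₂ a _) (cong (apply σ₂ a ++_)
          (trans (apply-++-++ σ₂ β α γ₂)
                 (cong₂ _++_ inputB (cong (apply σ₂ α ++_) (outside γ₂ (proj₂ frame))))))))

  canonicalSub : Sub
  canonicalSub x = [ vx (pv x) ]

  apply-canonicalSub : ∀ α → apply canonicalSub α ≡ map toPrem α
  apply-canonicalSub []          = refl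
  apply-canonicalSub (var x ∷ α) = cong (vx (pv x) ∷_) (apply-canonicalSub α)
  apply-canonicalSub (𝟏 ∷ α)     = cong (𝟏ᵖ ∷_) (apply-canonicalSub α)

  abstractPS-≡ : ∀ Γ hv →
    abstractPS P (zip (hypVertices hv) (map proj₁ Γ)) ≡ combsOf (PS.links P) ++ hypCombs canonicalSub Γ hv
  abstractPS-≡ []            []       = refl
  abstractPS-≡ ((α , _) ∷ Γ) (h ∷ hv) =
    cong (C ++_) (cong₂ _∷_ (cong (λ qs → comb qs (orig h)) (sym (apply-canonicalSub α)))
                            (++-cancelˡ C _ _ (abstractPS-≡ Γ hv)))
    where C = combsOf (PS.links P)

lookupF-∈ : ∀ {vs v A} → Unique (vertexIds vs) → (v , A) ∈ vs → lookupF vs v ≡ just A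
lookupF-∈ {(u , _) ∷ _} {v} (u∉ ∷ uq) v∈ with u ≟ v | v∈
... | yes _    | here refl = refl
... | yes refl | there v∈′ = ⊥-elim (All.lookup u∉ (∈-map⁺ proj₁ v∈′) refl)
... | no  u≢v  | here refl = ⊥-elim (u≢v refl)
... | no  _    | there v∈′ = lookupF-∈ uq v∈′

Labelled⇒Pointwise : ∀ {vs} Γ hv → Labelled Γ hv vs →
                     Pointwise (λ v A → (v , A) ∈ vs) (hypVertices hv) (map proj₂ Γ)
Labelled⇒Pointwise []      []       tt             = []
Labelled⇒Pointwise (_ ∷ Γ) (_ ∷ hv) ((h∈ , _) , L) = h∈ ∷ Labelled⇒Pointwise Γ hv L

lemma1 : ∀ {Γ : Ctx} {γ : Str} {C : Formula} (δ : Γ ⊢ γ ∶ C) → Fresh δ →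
    Σ PS λ P → IsProofNet P ×
    Σ (List ℕ) λ hs →
      Unique hs × (∀ v → IsHyp P v ⇔ (v ∈ hs)) ×
      Pointwise (λ v A → (v , A) ∈ PS.verts P) hs (map proj₂ Γ) ×
    Σ ℕ λ c →
      (∀ v → IsConcl P v ⇔ (v ≡ c)) × (c , C) ∈ PS.verts P ×
      Contracts (asort P) (abstractPS P (zip hs (map proj₁ Γ)))
                (comb (map toPrem γ) (orig c) ∷ [])
lemma1 {Γ} {γ} {C} δ fresh =
  P , (Γ , γ , C , δ , fresh , refl) ,
  hypVertices (TOut.hv t) , B.hyps-unique ,
  (λ v → mk⇔ (λ (v∈ , ¬c) → B.¬concl⇒hyp v∈ ¬c) (λ v∈ → S.hyp∈ v∈ , B.hyp⇒¬concl v∈)) ,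
  Labelled⇒Pointwise Γ (TOut.hv t) S.labelled ,
  TOut.root t ,
  (λ v → mk⇔ (λ (v∈ , ¬p) → B.¬prem⇒root v∈ ¬p) (λ { refl → S.root∈ids , B.root-¬prem })) ,
  S.root∈ ,
  ↠-singleton⇒Contracts (subst₂ _↠_ (sym (abstractPS-≡ Γ (TOut.hv t)))
    (cong (λ qs → [ comb qs (orig (TOut.root t)) ]) (apply-canonicalSub γ))
    (translate-yields 0 δ canonicalSub (λ x → stringVar x ∷ []) fresh (lookupF-∈ S.ids-unique)))
  where
    t = translate 0 δ
    P = netOf δ
    module S = Scoped (translate-scoped 0 δ)
    module B = Boundary (translate-boundary 0 δ)
    open Contraction P
    open UpToPermutation (asort P)
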